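{- Let $n$ be a positive integer and let $d=\big(1,2,\dots,q,q^{(s_q)},(q-1)^{(s_{q-1})},\dots,1^{(s_1)}\big)\in\Delta(n)$ with integers $q>0$, $s_1,\dots,s_q\ge0$. Let $L$ be the length of $d$ (index of its last nonzero entry), and set $b_i=d_i-d_{i+1}$ for $q\le i<L$, $b_L=d_L$. Then: (1) If $s_i\ge2$ for all $1\le i<q$, then $|[\,d\,]_q|=1$. (2) If $s_i\ge2$ for all $1\le i<q$ and $s_q\ge1$, then $|[\,d\,]|=\prod_{i=q}^{L}(b_i+1)$. (3) For every positive integer $m$ there exist a positive integer $n'$ and a partition $\alpha\in\mathcal{P}(n')$ such that, with $d'=\delta(\alpha)$, $|[\,d'\,]|=m$. (4) Suppose $d=\big(1,2,\dots,q,k^{(s_k)},(k-1)^{(s_{k-1})},\dots,1^{(s_1)}\big)$ with $k<q$ and $s_k\ge2$, and let $d'=\big(1,2,\dots,k,k^{(s_k)},(k-1)^{(s_{k-1})},\dots,1^{(s_1)}\big)$. Then $|[\,d\,]|=|[\,d'\,]|$. (5) Let $\sigma_i=\min\{s_i,2\}$ for $1\le i\le q$ and $d'=\big(1,2,\dots,q,q^{(\sigma_q)},(q-1)^{(\sigma_{q-1})},\dots,1^{(\sigma_1)}\big)$. Then $|[\,d\,]|=|[\,d'\,]|$.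
   Context: A partition is a non-increasing finite sequence $\alpha=(\alpha_1\ge\dots\ge\alpha_t\ge1)$ of positive integers (with $\alpha_i=0$ for $i>t$); $\mathcal{P}(n)$ denotes the partitions of $n$. Its diagonal sequence is $\delta(\alpha)=(d_k)_{k\ge1}$ with $d_k=\big|\{i:1\le i\le k,\ \alpha_i+i-1\ge k\}\big|$, trailing zeros omitted; $\Delta(n)=\{\delta(\alpha):\alpha\in\mathcal{P}(n)\}$. For a diagonal sequence $e$, $[\,e\,]$ is the set of partitions $\alpha$ with $\delta(\alpha)=e$ (all such $\alpha$ are partitions of $\sum_k e_k$), and $[\,e\,]_k$ is the subset of those with exactly $k$ nonzero parts. The notation $m^{(s)}$ means $s$ consecutive entries equal to $m$ (none if $s=0$). -}

module Defs where

open import Data.Nat using (ℕ; zero; suc; _+_; _*_; _∸_; _≤_; _<_; _≤ᵇ_; _≡ᵇ_; _<ᵇ_)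
open import Data.Nat.ListAction using (sum; product)
open import Data.List using (List; []; _∷_; length; map; upTo; filterᵇ; dropWhileᵇ; reverse; replicate; _++_)
open import Data.List.Relation.Unary.All using (All)
open import Data.List.Relation.Unary.Linked using (Linked)
open import Data.List.Relation.Unary.Unique.Propositional using (Unique)
open import Data.List.Membership.Propositional using (_∈_)
open import Data.Product using (Σ; ∃; _×_)
open import Data.Bool using (if_then_else_)
open import Function.Bundles using (_⇔_)
open import Relation.Binary.PropositionalEquality using (_≡_)

IsPartition : List ℕ → Set
IsPartition α = All (0 <_) α × Linked (λ a b → b ≤ a) α

IsPartitionOf : ℕ → List ℕ → Set
IsPartitionOf n α = IsPartition α × sum α ≡ n

-- 1-indexed entry of a list, 0 beyond its end (and at index 0)
at : List ℕ → ℕ → ℕ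
at []       _             = 0
at (x ∷ xs) zero          = 0
at (x ∷ xs) (suc zero)    = x
at (x ∷ xs) (suc (suc i)) = at xs (suc i)

-- the list [a, a+1, ..., b]  (empty if b < a)
range : ℕ → ℕ → List ℕ
range a b = map (a +_) (upTo (suc b ∸ a))

diagEntry : List ℕ → ℕ → ℕ
diagEntry α k = length (filterᵇ (λ i → k ≤ᵇ (at α i + i) ∸ 1) (range 1 k))

stripZeros : List ℕ → List ℕ
stripZeros xs = reverse (dropWhileᵇ (λ x → x ≡ᵇ 0) (reverse (xs)))

-- δ(α): the entries d_k for k = 1 .. sum α (all d_k with k > sum α vanish,
-- since α_i + i - 1 ≤ α_1 + ... + α_i), trailing zeros omitted.
δ : List ℕ → List ℕ
δ α = stripZeros (map (diagEntry α) (range 1 (sum α)))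

InΔ : ℕ → List ℕ → Set
InΔ n e = Σ (List ℕ) λ α → IsPartitionOf n α × δ α ≡ e

InClass : List ℕ → List ℕ → Set
InClass e α = IsPartition α × δ α ≡ e

InClassParts : List ℕ → ℕ → List ℕ → Set
InClassParts e k α = InClass e α × length α ≡ k

-- |{ α : P α }| = m  : the set is finite, listed without repetition by a list of length m
HasSize : (List ℕ → Set) → ℕ → Set
HasSize P m = Σ (List (List ℕ)) λ xs →
  Unique xs × (∀ α → (α ∈ xs) ⇔ P α) × length xs ≡ m

SameSize : (List ℕ → Set) → (List ℕ → Set) → Set
SameSize P Q = Σ ℕ λ m → HasSize P m × HasSize Q m

stair : ℕ → List ℕ
stair q = range 1 q

downBlocks : ℕ → (ℕ → ℕ) → List ℕ
downBlocks zero    s = []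
downBlocks (suc i) s = replicate (s (suc i)) (suc i) ++ downBlocks i s

dSeq : ℕ → (ℕ → ℕ) → List ℕ
dSeq q s = stair q ++ downBlocks q s

cap2 : (ℕ → ℕ) → ℕ → ℕ
cap2 s i = if s i ≤ᵇ 2 then s i else 2

bEntry : List ℕ → ℕ → ℕ
bEntry d i = if i <ᵇ length d then at d i ∸ at d (suc i) else at d (length d)

bProduct : ℕ → List ℕ → ℕ
bProduct q d = product (map (λ i → bEntry d i + 1) (range q (length d)))

-- Since d_{k+1}(a ∷ β) = [k+1 ≤ a] + d_k(β), a partition α lies in [ e ] exactly when
-- d_{k+1}(α) = e_{k+1} for all k, and every part is proved by explicit bijections between
-- such classes, built by deleting or inserting rows, columns or cells of the Young diagram.
-- If d = (1, e'+1, 1^r) has length L and its last entries are ≤ 1 and = 1, the cell on the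
-- last diagonal lies in a first row or a first column of length L, never both; deleting it
-- gives [ d ] ≅ [ e' ] ⊎ [ e' ]. Iterating from d = (1,…,q, q^(s_q), …) yields
-- |[ d ]| = 2^q = ∏ (b_i + 1) for (2), and with exactly q parts the first row is forced, which
-- gives (1). For (3), (1,…,p,1) splits into (1,…,p-1) and (1,…,p-1,1): it has p+1 partitions.
-- For (5), a plateau d_K = d_{K+1} < K can be lengthened by one entry bijectively, so blocks
-- of equal entries may be cut down to length 2; for (4), a staircase followed by v, v with
-- v below its top can be shortened by one step bijectively.

module Submission where

open import Defs
open import Data.Nat
open import Data.Nat.Properties
open import Data.Nat.ListAction using (sum; product)
open import Data.Bool using (Bool; true; false; if_then_else_)
open import Data.List using (List; []; _∷_; length; map; upTo; filterᵇ; _++_; replicate; reverse; dropWhileᵇ; concat; filter; deduplicate; _ʳ++_)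
open import Data.List.Properties using (map-applyUpTo; reverse-++; reverse-involutive; unfold-reverse; length-++; length-replicate; length-map; ≡-dec; map-++; ++-assoc; ++-identityʳ; map-replicate; map-cong-local; upTo-∷ʳ)
import Data.List.Properties as LP
open import Data.List.Relation.Unary.All using (All; []; _∷_; all?)
import Data.List.Relation.Unary.All as All
import Data.List.Relation.Unary.All.Properties as Allₚ
open import Data.List.Relation.Unary.Any using (here; there)
open import Data.List.Relation.Unary.Linked using (Linked; []; [-]; _∷_; linked?)
open import Data.List.Relation.Unary.Unique.Propositional using (Unique)
open import Data.List.Relation.Unary.AllPairs using ([]; _∷_)
open import Data.List.Relation.Unary.Unique.Propositional.Properties using (++⁺)
import Data.List.Relation.Unary.Unique.DecPropositional.Properties as UDP
open import Data.List.Membership.Propositional using (_∈_)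
open import Data.List.Membership.Propositional.Properties
open import Data.Product using (_×_; _,_; proj₁; proj₂; Σ; ∃)
open import Data.Sum using (_⊎_; inj₁; inj₂)
open import Data.Empty using (⊥; ⊥-elim)
open import Function using (id; _∘_)
open import Function.Bundles using (_⇔_; mk⇔; module Equivalence)
open Equivalence using () renaming (to to to⇔; from to from⇔)
open import Relation.Binary.PropositionalEquality
open import Relation.Nullary using (¬_; yes; no; Dec)
open import Relation.Nullary.Decidable using (_×-dec_)

range1-suc : ∀ k → range 1 (suc k) ≡ 1 ∷ map suc (range 1 k)
range1-suc k = cong (λ z → 1 ∷ map suc z) (sym (map-applyUpTo id suc k))

range1-bounded : ∀ k → All (λ i → 1 ≤ i × i ≤ k) (range 1 k)
range1-bounded zero = []
range1-bounded (suc k) rewrite range1-suc k = (s≤s z≤n , s≤s z≤n) ∷ Allₚ.map⁺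
    (All.map (λ { (p , q) → s≤s z≤n , s≤s q }) (range1-bounded k))

at-beyond-length : ∀ xs k → length xs ≤ k → at xs (suc k) ≡ 0
at-beyond-length [] k _ = refl
at-beyond-length (x ∷ []) (suc k) _ = refl
at-beyond-length (x ∷ y ∷ xs) (suc k) (s≤s p) = at-beyond-length (y ∷ xs) k p

at-++-zeros : ∀ xs j i → at (xs ++ replicate j 0) i ≡ at xs i
at-++-zeros [] zero i = refl
at-++-zeros [] (suc j) zero = refl
at-++-zeros [] (suc j) (suc zero) = refl
at-++-zeros [] (suc zero) (suc (suc i)) = refl
at-++-zeros [] (suc (suc j)) (suc (suc i)) = at-++-zeros [] (suc j) (suc i)
at-++-zeros (x ∷ xs) j zero = refl
at-++-zeros (x ∷ xs) j (suc zero) = refl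
at-++-zeros (x ∷ []) j (suc (suc i)) = at-++-zeros [] j (suc i)
at-++-zeros (x ∷ y ∷ xs) j (suc (suc i)) = at-++-zeros (y ∷ xs) j (suc i)

at-∷ : ∀ x xs i → at (x ∷ xs) (suc (suc i)) ≡ at xs (suc i)
at-∷ x [] i = refl
at-∷ x (y ∷ xs) i = refl

at-map-range1 : ∀ f N k → suc k ≤ N → at (map f (range 1 N)) (suc k) ≡ f (suc k)
at-map-range1 f (suc N) zero _ = cong (λ z → at (map f z) 1) (range1-suc N)
at-map-range1 f (suc N) (suc k) (s≤s p) =
  trans (cong (λ z → at (map f z) (suc (suc k))) (range1-suc N))
  (trans (at-∷ (f 1) (map f (map suc (range 1 N))) k)
   (trans (cong (λ z → at z (suc k)) (sym (LP.map-∘ (range 1 N)))) (at-map-range1 (f ∘ suc) N k p)))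

length-range1 : ∀ N → length (range 1 N) ≡ N
length-range1 zero = refl
length-range1 (suc N) = trans (cong length (range1-suc N)) (cong suc (trans (length-map suc (range 1 N)) (length-range1 N)))

at-extensional : ∀ xs ys → length xs ≡ length ys → (∀ k → at xs (suc k) ≡ at ys (suc k)) → xs ≡ ys
at-extensional [] [] _ _ = refl
at-extensional (x ∷ xs) (y ∷ ys) l h = cong₂ _∷_ (h 0) (at-extensional xs ys (suc-injective l) h')
  where
  h' : ∀ k → at xs (suc k) ≡ at ys (suc k)
  h' k = trans (sym (at-∷ x xs k)) (trans (h (suc k)) (at-∷ y ys k))

at-last-positive : ∀ x xs → All (0 <_) (x ∷ xs) → 0 < at (x ∷ xs) (length (x ∷ xs))
at-last-positive x [] (p ∷ _) = p
at-last-positive x (y ∷ xs) (_ ∷ ps) = at-last-positive y xs ps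

∈-range1 : ∀ x h → 1 ≤ x → x ≤ h → x ∈ range 1 h
∈-range1 (suc zero) (suc h) _ _ = subst (1 ∈_) (sym (range1-suc h)) (here refl)
∈-range1 (suc (suc x)) (suc h) _ (s≤s le) = subst (suc (suc x) ∈_) (sym (range1-suc h))
    (there (∈-map⁺ suc (∈-range1 (suc x) h (s≤s z≤n) le)))

at-positive⇒≤length : ∀ e k → 1 ≤ at e k → k ≤ length e
at-positive⇒≤length e zero _ = z≤n
at-positive⇒≤length e (suc k) p with length e ≤? k
... | yes le = ⊥-elim (<-irrefl (sym (at-beyond-length e k le)) p)
... | no nle = ≰⇒> nle

at-0 : ∀ e → at e 0 ≡ 0
at-0 [] = refl
at-0 (x ∷ e) = refl

at-++ˡ : ∀ xs ys k → k < length xs → at (xs ++ ys) (suc k) ≡ at xs (suc k)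
at-++ˡ (x ∷ xs) ys zero _ = refl
at-++ˡ (x ∷ xs) ys (suc k) (s≤s p) = trans (at-∷ x (xs ++ ys) k) (trans (at-++ˡ xs ys k p) (sym (at-∷ x xs k)))

at-++ʳ : ∀ xs ys k → at (xs ++ ys) (suc (length xs + k)) ≡ at ys (suc k)
at-++ʳ [] ys k = refl
at-++ʳ (x ∷ xs) ys k = trans (at-∷ x (xs ++ ys) (length xs + k)) (at-++ʳ xs ys k)

at-map : ∀ f xs k → k < length xs → at (map f xs) (suc k) ≡ f (at xs (suc k))
at-map f (x ∷ xs) zero _ = refl
at-map f (x ∷ xs) (suc k) (s≤s p) = trans (at-∷ (f x) (map f xs) k) (trans (at-map f xs k p) (cong f (sym (at-∷ x xs k))))

at-replicate : ∀ r x k → k < r → at (replicate r x) (suc k) ≡ x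
at-replicate (suc r) x zero _ = refl
at-replicate (suc r) x (suc k) (s≤s p) = trans (at-∷ x (replicate r x) k) (at-replicate r x k p)

at-positive : ∀ e k → All (0 <_) e → k < length e → 1 ≤ at e (suc k)
at-positive (x ∷ e) zero (p ∷ _) _ = p
at-positive (x ∷ e) (suc k) (_ ∷ ps) (s≤s l) = subst (1 ≤_) (sym (at-∷ x e k)) (at-positive e k ps l)

at-ones-≤1 : ∀ n k → at (replicate n 1) k ≤ 1
at-ones-≤1 zero k = z≤n
at-ones-≤1 (suc n) zero = z≤n
at-ones-≤1 (suc zero) (suc zero) = ≤-refl
at-ones-≤1 (suc zero) (suc (suc k)) = z≤n
at-ones-≤1 (suc (suc n)) (suc zero) = ≤-refl
at-ones-≤1 (suc (suc n)) (suc (suc k)) = at-ones-≤1 (suc n) (suc k)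

isZero : ℕ → Bool
isZero x = x ≡ᵇ 0

dropZeros-prefix : ∀ ys → ∃ λ j → ys ≡ replicate j 0 ++ dropWhileᵇ isZero ys
dropZeros-prefix [] = 0 , refl
dropZeros-prefix (zero ∷ ys) with dropZeros-prefix ys
... | j , e = suc j , cong (0 ∷_) e
dropZeros-prefix (suc y ∷ ys) = 0 , refl

reverse-zeros : ∀ j → reverse (replicate j 0) ≡ replicate j 0
reverse-zeros zero = refl
reverse-zeros (suc j) = trans (unfold-reverse 0 (replicate j 0))
    (trans (cong (_++ (0 ∷ [])) (reverse-zeros j)) (sym (rep-snoc j)))
  where
  rep-snoc : ∀ j → 0 ∷ replicate j 0 ≡ replicate j 0 ++ (0 ∷ [])
  rep-snoc zero = refl
  rep-snoc (suc j) = cong (0 ∷_) (rep-snoc j)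

stripZeros-suffix : ∀ xs → ∃ λ j → xs ≡ stripZeros xs ++ replicate j 0
stripZeros-suffix xs with dropZeros-prefix (reverse xs)
... | j , e = j , (begin
    xs ≡⟨ sym (reverse-involutive xs) ⟩
    reverse (reverse xs) ≡⟨ cong reverse e ⟩
    reverse (replicate j 0 ++ D) ≡⟨ reverse-++ (replicate j 0) D ⟩
    reverse D ++ reverse (replicate j 0) ≡⟨ cong (reverse D ++_) (reverse-zeros j) ⟩
    stripZeros xs ++ replicate j 0 ∎)
  where
  open ≡-Reasoning
  D = dropWhileᵇ isZero (reverse xs)

dropZeros-zeros++ : ∀ j ys → dropWhileᵇ isZero (replicate j 0 ++ ys) ≡ dropWhileᵇ isZero ys
dropZeros-zeros++ zero ys = refl
dropZeros-zeros++ (suc j) ys = dropZeros-zeros++ j ys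

All-reverse : ∀ {P : ℕ → Set} xs → All P xs → All P (reverse xs)
All-reverse {P} xs a = go xs [] a []
  where
  go : ∀ xs acc → All P xs → All P acc → All P (xs ʳ++ acc)
  go [] acc [] b = b
  go (x ∷ xs) acc (p ∷ ps) b = go xs (x ∷ acc) ps (p ∷ b)

dropZeros-positive : ∀ ys → All (0 <_) ys → dropWhileᵇ isZero ys ≡ ys
dropZeros-positive [] _ = refl
dropZeros-positive (suc y ∷ ys) _ = refl
dropZeros-positive (zero ∷ ys) (() ∷ _)

stripZeros-positive : ∀ e j → All (0 <_) e → stripZeros (e ++ replicate j 0) ≡ e
stripZeros-positive e j pe = begin
  reverse (dropWhileᵇ isZero (reverse (e ++ replicate j 0))) ≡⟨ cong (reverse ∘ dropWhileᵇ isZero)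
      (reverse-++ e (replicate j 0)) ⟩
  reverse (dropWhileᵇ isZero (reverse (replicate j 0) ++ reverse e)) ≡⟨ cong (λ z → reverse
      (dropWhileᵇ isZero (z ++ reverse e))) (reverse-zeros j) ⟩
  reverse (dropWhileᵇ isZero (replicate j 0 ++ reverse e)) ≡⟨ cong reverse (dropZeros-zeros++ j (reverse e)) ⟩
  reverse (dropWhileᵇ isZero (reverse e)) ≡⟨ cong reverse (dropZeros-positive (reverse e) (All-reverse e pe)) ⟩
  reverse (reverse e) ≡⟨ reverse-involutive e ⟩
  e ∎
  where open ≡-Reasoning

-- Diagonal counts

reaches : ℕ → ℕ → ℕ
reaches a zero = 1
reaches zero (suc k) = 0
reaches (suc a) (suc k) = reaches a k

-- diag α k is d_k(α): row i of α contributes to d_k exactly when α_i ≥ k - i + 1,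
-- so deleting the first row shifts the remaining contributions down by one index.
diag : List ℕ → ℕ → ℕ
diag [] k = 0
diag (a ∷ β) zero = 0
diag (a ∷ β) (suc k) = reaches a (suc k) + diag β k

countReaching : ℕ → (ℕ → ℕ) → List ℕ → ℕ
countReaching k f [] = 0
countReaching k f (x ∷ xs) = reaches (f x) k + countReaching k f xs

if-≤ᵇ≡reaches : ∀ k a → (if k ≤ᵇ a then 1 else 0) ≡ reaches a k
if-≤ᵇ≡reaches zero a = refl
if-≤ᵇ≡reaches (suc k) zero = refl
if-≤ᵇ≡reaches (suc zero) (suc a) = refl
if-≤ᵇ≡reaches (suc (suc k)) (suc a) = if-≤ᵇ≡reaches (suc k) a

length-filter≡countReaching : ∀ k f xs → length (filterᵇ (λ i → k ≤ᵇ f i) xs) ≡ countReaching k f xs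
length-filter≡countReaching k f [] = refl
length-filter≡countReaching k f (x ∷ xs) with k ≤ᵇ f x in eq
... | true = cong₂ _+_ (trans (cong (λ b → if b then 1 else 0) (sym eq)) (if-≤ᵇ≡reaches k (f x)))
    (length-filter≡countReaching k f xs)
... | false = cong₂ _+_ (trans (cong (λ b → if b then 1 else 0) (sym eq)) (if-≤ᵇ≡reaches k (f x)))
    (length-filter≡countReaching k f xs)

countReaching-cong : ∀ k k' f g xs → All (λ x → reaches (f x) k ≡ reaches (g x) k') xs →
  countReaching k f xs ≡ countReaching k' g xs
countReaching-cong k k' f g [] [] = refl
countReaching-cong k k' f g (x ∷ xs) (e ∷ es) = cong₂ _+_ e (countReaching-cong k k' f g xs es)

countReaching-map : ∀ k f h xs → countReaching k f (map h xs) ≡ countReaching k (f ∘ h) xs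
countReaching-map k f h [] = refl
countReaching-map k f h (x ∷ xs) = cong (reaches (f (h x)) k +_) (countReaching-map k f h xs)

countReaching-zero : ∀ k f xs → All (λ x → reaches (f x) k ≡ 0) xs → countReaching k f xs ≡ 0
countReaching-zero k f [] [] = refl
countReaching-zero k f (x ∷ xs) (e ∷ es) = cong₂ _+_ e (countReaching-zero k f xs es)

reaches-< : ∀ a k → a < k → reaches a k ≡ 0
reaches-< zero (suc k) _ = refl
reaches-< (suc a) (suc k) (s≤s p) = reaches-< a k p

diagEntry-[]-terms : ∀ k {xs} → All (λ i → 1 ≤ i × i ≤ k) xs → All (λ i → reaches ((at [] i + i) ∸ 1) k ≡ 0) xs
diagEntry-[]-terms k [] = []
diagEntry-[]-terms k (_∷_ {x = suc i} (_ , s≤s q) ps) = reaches-< i k (s≤s q) ∷ diagEntry-[]-terms k ps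

diagEntry-∷-terms : ∀ a β k {xs} → All (λ i → 1 ≤ i × i ≤ k) xs →
  All (λ i → reaches ((at (a ∷ β) (suc i) + suc i) ∸ 1) (suc k) ≡ reaches ((at β i + i) ∸ 1) k) xs
diagEntry-∷-terms a β k [] = []
diagEntry-∷-terms a β k (_∷_ {x = suc i} _ ps) = cong (λ z → reaches z (suc k))
    (lemma (at β (suc i)) i) ∷ diagEntry-∷-terms a β k ps
  where
  lemma : ∀ x i → x + suc (suc i) ∸ 1 ≡ suc (x + suc i ∸ 1)
  lemma x i rewrite +-suc x (suc i) | +-suc x i = refl

diagEntry≡diag : ∀ α k → diagEntry α k ≡ diag α k
diagEntry≡diag [] k = trans (length-filter≡countReaching k (λ i → (at [] i + i) ∸ 1) (range 1 k))
    (countReaching-zero k _ _ (diagEntry-[]-terms k (range1-bounded k)))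
diagEntry≡diag (a ∷ β) zero = refl
diagEntry≡diag (a ∷ β) (suc k) =
  begin
    diagEntry (a ∷ β) (suc k)
  ≡⟨ length-filter≡countReaching (suc k) f (range 1 (suc k)) ⟩
    countReaching (suc k) f (range 1 (suc k))
  ≡⟨ cong (countReaching (suc k) f) (range1-suc k) ⟩
    reaches (f 1) (suc k) + countReaching (suc k) f (map suc (range 1 k))
  ≡⟨ cong₂ _+_ (cong (λ z → reaches z (suc k)) (trans (cong (_∸ 1) (+-comm a 1)) refl))
      (countReaching-map (suc k) f suc (range 1 k)) ⟩
    reaches a (suc k) + countReaching (suc k) (f ∘ suc) (range 1 k)
  ≡⟨ cong (reaches a (suc k) +_) (countReaching-cong (suc k) k (f ∘ suc) (λ i → (at β i + i) ∸ 1) (range 1 k)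
      (diagEntry-∷-terms a β k (range1-bounded k))) ⟩
    reaches a (suc k) + countReaching k (λ i → (at β i + i) ∸ 1) (range 1 k)
  ≡⟨ cong (reaches a (suc k) +_) (sym (trans (sym (diagEntry≡diag β k)) (length-filter≡countReaching k _ (range 1 k)))) ⟩
    reaches a (suc k) + diag β k
  ∎
  where
  open ≡-Reasoning
  f : ℕ → ℕ
  f i = (at (a ∷ β) i + i) ∸ 1

reaches-≤1 : ∀ a k → reaches a k ≤ 1
reaches-≤1 a zero = ≤-refl
reaches-≤1 zero (suc k) = z≤n
reaches-≤1 (suc a) (suc k) = reaches-≤1 a k

diag-≤ : ∀ α k → diag α k ≤ k
diag-≤ [] k = z≤n
diag-≤ (a ∷ β) zero = z≤n
diag-≤ (a ∷ β) (suc k) = +-mono-≤ (reaches-≤1 a (suc k)) (diag-≤ β k)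

reaches-refl : ∀ a → reaches a a ≡ 1
reaches-refl zero = refl
reaches-refl (suc a) = reaches-refl a

reaches-≤ : ∀ a k → k ≤ a → reaches a k ≡ 1
reaches-≤ a zero _ = refl
reaches-≤ (suc a) (suc k) (s≤s p) = reaches-≤ a k p

reaches-suc-≤ : ∀ a k → reaches a (suc k) ≤ reaches a k
reaches-suc-≤ a zero = reaches-≤1 a 1
reaches-suc-≤ zero (suc k) = z≤n
reaches-suc-≤ (suc a) (suc k) = reaches-suc-≤ a k

diag-0 : ∀ β → diag β 0 ≡ 0
diag-0 [] = refl
diag-0 (_ ∷ _) = refl

reaches-mono : ∀ a b k → a ≤ b → reaches a k ≤ reaches b k
reaches-mono a b zero _ = ≤-refl
reaches-mono zero b (suc k) _ = z≤n
reaches-mono (suc a) (suc b) (suc k) (s≤s p) = reaches-mono a b k p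

diag-beyond-sum : ∀ α k → All (0 <_) α → sum α < k → diag α k ≡ 0
diag-beyond-sum [] k _ _ = refl
diag-beyond-sum (a ∷ β) zero _ ()
diag-beyond-sum (a ∷ β) (suc k) (pa ∷ pβ) (s≤s lt) =
  cong₂ _+_ (reaches-< a (suc k) (s≤s (≤-trans (m≤m+n a (sum β)) lt)))
            (diag-beyond-sum β k pβ (≤-trans (+-monoˡ-≤ (sum β) pa) lt))

diag-positive⇒≤sum : ∀ α k → All (0 <_) α → 0 < diag α k → k ≤ sum α
diag-positive⇒≤sum α k pα lt with k ≤? sum α
... | yes p = p
... | no np = ⊥-elim (<-irrefl (sym (diag-beyond-sum α k pα (≰⇒> np))) lt)

head-bounds-partition : ∀ a β → Linked (λ x y → y ≤ x) (a ∷ β) → All (_≤ a) (a ∷ β)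
head-bounds-partition a [] _ = ≤-refl ∷ []
head-bounds-partition a (b ∷ β) (r ∷ l) = ≤-refl ∷ All.map (λ p → ≤-trans p r) (head-bounds-partition b β l)

diag-head : ∀ a β → 0 < a → 1 ≤ diag (a ∷ β) a
diag-head (suc a) β _ = subst (λ z → 1 ≤ z + diag β a) (sym (reaches-refl a)) (s≤s z≤n)

diag-length : ∀ α → All (0 <_) α → α ≢ [] → 1 ≤ diag α (length α)
diag-length [] _ ne = ⊥-elim (ne refl)
diag-length (suc a ∷ []) _ _ = s≤s z≤n
diag-length (a ∷ b ∷ β) (_ ∷ pβ) _ = ≤-trans (diag-length (b ∷ β) pβ (λ ()))
    (m≤n+m (diag (b ∷ β) (suc (length β))) (reaches a (suc (suc (length β)))))

hd : List ℕ → ℕ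
hd [] = 0
hd (a ∷ _) = a

tl : List ℕ → List ℕ
tl [] = []
tl (_ ∷ β) = β

IsPartition-tail : ∀ a β → IsPartition (a ∷ β) → IsPartition β
IsPartition-tail a β (_ ∷ pβ , l) = pβ , lk l
  where
  lk : Linked (λ x y → y ≤ x) (a ∷ β) → Linked (λ x y → y ≤ x) β
  lk [-] = []
  lk (_ ∷ l) = l

IsPartition-head : ∀ a β → IsPartition (a ∷ β) → hd β ≤ a
IsPartition-head a [] _ = z≤n
IsPartition-head a (b ∷ β) (_ , r ∷ _) = r

IsPartition-∷ : ∀ a β → 0 < a → hd β ≤ a → IsPartition β → IsPartition (a ∷ β)
IsPartition-∷ a [] pa _ _ = pa ∷ [] , [-]
IsPartition-∷ a (b ∷ β) pa r (pβ , l) = pa ∷ pβ , r ∷ l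

diag-full⇒≤hd : ∀ β k → diag β (suc k) ≡ suc k → suc k ≤ hd β
diag-full⇒≤hd [] k ()
diag-full⇒≤hd (b ∷ β) k e with suc k ≤? b
... | yes p = p
... | no np = ⊥-elim (<-irrefl refl (subst (_≤ k) e' (diag-≤ β k)))
  where e' : diag β k ≡ suc k
        e' = trans (sym (cong (_+ diag β k) (reaches-< b (suc k) (≰⇒> np)))) e

diag-increase⇒full : ∀ α k → IsPartition α → diag α k < diag α (suc k) → diag α k ≡ k
diag-increase⇒full [] k _ ()
diag-increase⇒full (a ∷ β) zero _ _ = refl
diag-increase⇒full (a ∷ β) (suc k) ip lt = res
  where
  ipβ = IsPartition-tail a β ip
  βinc : diag β k < diag β (suc k)
  βinc with diag β k <? diag β (suc k)
  ... | yes p = p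
  ... | no np = ⊥-elim (<⇒≱ lt (+-mono-≤ (reaches-suc-≤ a (suc k)) (≮⇒≥ np)))
  ih : diag β k ≡ k
  ih = diag-increase⇒full β k ipβ βinc
  res : reaches a (suc k) + diag β k ≡ suc k
  res with suc k ≤? a
  ... | yes p = cong₂ _+_ (reaches-≤ a (suc k) p) ih
  ... | no np = ⊥-elim (<-irrefl refl (≤-trans (diag-full⇒≤hd β k full)
      (≤-trans (IsPartition-head a β ip) (≤-pred (≰⇒> np)))))
    where
    g0 = reaches-< a (suc k) (≰⇒> np)
    g0' = reaches-< a (suc (suc k)) (m≤n⇒m≤1+n (≰⇒> np))
    full : diag β (suc k) ≡ suc k
    full = ≤-antisym (diag-≤ β (suc k)) (subst (_< diag β (suc k)) ih
        (subst₂ _<_ (trans (cong (_+ diag β k) g0) refl) (cong (_+ diag β (suc k)) g0') lt))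

diag-row : ∀ β k → All (0 <_) β → suc k ≤ length β → 1 ≤ diag β (suc k)
diag-row (suc b ∷ β) zero _ _ = s≤s z≤n
diag-row (b ∷ β) (suc k) (_ ∷ p) (s≤s le) = ≤-trans (diag-row β k p le) (m≤n+m (diag β (suc k)) (reaches b (suc (suc k))))

diag-1⇒nonempty : ∀ β → 1 ≤ diag β 1 → 1 ≤ length β
diag-1⇒nonempty [] ()
diag-1⇒nonempty (_ ∷ _) _ = s≤s z≤n

corner-in-first-row-or-column : ∀ α K → IsPartition α → 1 ≤ K → 1 ≤ diag α (suc K) → diag α K ≤ 1 →
  suc K ≤ hd α ⊎ suc K ≤ length α
corner-in-first-row-or-column [] K _ _ () _
corner-in-first-row-or-column (a ∷ β) (suc zero) ip pK p1 p2 with 2 ≤? a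
... | yes q = inj₁ q
... | no nq = inj₂ (s≤s (diag-1⇒nonempty β (subst (1 ≤_) (cong (_+ diag β 1) (reaches-< a _ (≰⇒> nq))) p1)))
corner-in-first-row-or-column (a ∷ β) (suc (suc K)) ip pK p1 p2 with suc (suc (suc K)) ≤? a
... | yes q = inj₁ q
... | no nq with suc (suc K) ≤? a
...   | yes r = ⊥-elim (0≢1+n (trans (sym z) full))
  where
  ipβ = IsPartition-tail a β ip
  lβ : 1 ≤ diag β (suc (suc K))
  lβ = subst (1 ≤_) (cong (_+ diag β (suc (suc K))) (reaches-< a _ (≰⇒> nq))) p1
  z : diag β (suc K) ≡ 0
  z = n≤0⇒n≡0 (≤-pred (subst (λ w → w + diag β (suc K) ≤ 1) (reaches-≤ a (suc (suc K)) r) p2))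
  full : diag β (suc K) ≡ suc K
  full = diag-increase⇒full β (suc K) ipβ (subst (_< diag β (suc (suc K))) (sym z) lβ)
...   | no nr with corner-in-first-row-or-column β (suc K) (IsPartition-tail a β ip) (s≤s z≤n)
    (subst (1 ≤_) (cong (_+ diag β (suc (suc K))) (reaches-< a _ (≰⇒> nq))) p1)
    (subst (λ w → w + diag β (suc K) ≤ 1) (reaches-< a (suc (suc K)) (≰⇒> nr)) p2)
...     | inj₁ h = ⊥-elim (<-irrefl refl (≤-trans (s≤s (≤-trans h (IsPartition-head a β ip))) (≰⇒> nr)))
...     | inj₂ l = inj₂ (s≤s l)

diag-suc-≤ : ∀ β i → IsPartition β → diag β (suc i) ≤ suc (diag β i)
diag-suc-≤ β i ip with diag β i <? diag β (suc i)
... | yes p = subst (λ z → diag β (suc i) ≤ suc z) (sym (diag-increase⇒full β i ip p)) (diag-≤ β (suc i))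
... | no np = ≤-trans (≮⇒≥ np) (n≤1+n _)

diag-full-below : ∀ β k → IsPartition β → diag β k ≡ k → ∀ i → i ≤ k → diag β i ≡ i
diag-full-below β k ip e i le = ≤-antisym (diag-≤ β i) (go k e le)
  where
  go : ∀ k → diag β k ≡ k → i ≤ k → i ≤ diag β i
  go k e le with m≤n⇒m<n∨m≡n le
  ... | inj₂ refl = ≤-reflexive (sym e)
  ... | inj₁ lt with k
  ...   | suc k' = go k' e' (≤-pred lt)
    where
    e' : diag β k' ≡ k'
    e' = ≤-antisym (diag-≤ β k') (≤-pred (subst (_≤ suc (diag β k')) e (diag-suc-≤ β k' ip)))

private
  diagEntries : List ℕ → List ℕ
  diagEntries α = map (diagEntry α) (range 1 (sum α))

  at-diagEntries : ∀ α k → All (0 <_) α → at (diagEntries α) (suc k) ≡ diag α (suc k)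
  at-diagEntries α k pα with suc k ≤? sum α
  ... | yes p = trans (at-map-range1 (diagEntry α) (sum α) k p) (diagEntry≡diag α (suc k))
  ... | no np = trans (at-beyond-length (diagEntries α) k
      (≤-trans (≤-reflexive (trans (length-map (diagEntry α) (range 1 (sum α))) (length-range1 (sum α)))) (≤-pred (≰⇒> np))))
                      (sym (diag-beyond-sum α (suc k) pα (≰⇒> np)))

δ≡⇒diag≡ : ∀ α e → IsPartition α → δ α ≡ e → ∀ k → diag α (suc k) ≡ at e (suc k)
δ≡⇒diag≡ α e (pα , _) eq k with stripZeros-suffix (diagEntries α)
... | j , d = trans (sym (at-diagEntries α k pα))
    (trans (cong (λ z → at z (suc k)) d) (trans (at-++-zeros (δ α) j (suc k)) (cong (λ z → at z (suc k)) eq)))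

diag≡⇒length≤sum : ∀ α e → All (0 <_) α → All (0 <_) e → (∀ k → diag α (suc k) ≡ at e (suc k)) → length e ≤ sum α
diag≡⇒length≤sum α [] pα pe h = z≤n
diag≡⇒length≤sum α (x ∷ xs) pα pe h = diag-positive⇒≤sum α (length (x ∷ xs)) pα
    (subst (0 <_) (sym (h (length xs))) (at-last-positive x xs pe))

diag≡⇒δ≡ : ∀ α e → IsPartition α → All (0 <_) e → (∀ k → diag α (suc k) ≡ at e (suc k)) → δ α ≡ e
diag≡⇒δ≡ α e (pα , _) pe h = trans (cong stripZeros xs≡) (stripZeros-positive e (sum α ∸ length e) pe)
  where
  lenle = diag≡⇒length≤sum α e pα pe h
  xs≡ : diagEntries α ≡ e ++ replicate (sum α ∸ length e) 0
  xs≡ = at-extensional (diagEntries α) (e ++ replicate (sum α ∸ length e) 0)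
          (trans (trans (length-map (diagEntry α) (range 1 (sum α))) (length-range1 (sum α)))
                 (sym (trans (length-++ e)
                     (trans (cong (length e +_) (length-replicate (sum α ∸ length e))) (m+[n∸m]≡n lenle)))))
          (λ k → trans (at-diagEntries α k pα) (trans (h k) (sym (at-++-zeros e (sum α ∸ length e) (suc k)))))

Pred : Set₁
Pred = List ℕ → Set

InClass-bounded : ∀ e α → InClass e α → All (λ x → 1 ≤ x × x ≤ length e) α × length α ≤ length e
InClass-bounded e [] _ = [] , z≤n
InClass-bounded e (a ∷ β) (ip@(pα , lk) , eq) = go (a ∷ β) pα (head-bounds-partition a β lk) , lenb
  where
  diag≡ : ∀ k → diag (a ∷ β) k ≡ at e k
  diag≡ zero = sym (at-0 e)
  diag≡ (suc k) = δ≡⇒diag≡ (a ∷ β) e ip eq k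
  ha : a ≤ length e
  ha = at-positive⇒≤length e a (subst (1 ≤_) (diag≡ a) (diag-head a β (All.head pα)))
  go : ∀ xs → All (0 <_) xs → All (_≤ a) xs → All (λ x → 1 ≤ x × x ≤ length e) xs
  go [] _ _ = []
  go (x ∷ xs) (p ∷ ps) (q ∷ qs) = (p , ≤-trans q ha) ∷ go xs ps qs
  lenb : length (a ∷ β) ≤ length e
  lenb = at-positive⇒≤length e (length (a ∷ β)) (subst (1 ≤_) (diag≡ (length (a ∷ β))) (diag-length (a ∷ β) pα (λ ())))

-- Only F (suc k) matters: d_0 is not part of a diagonal sequence.
HasDiag : (ℕ → ℕ) → Pred
HasDiag F α = IsPartition α × (∀ k → diag α (suc k) ≡ F (suc k))

HasDiag-ext : ∀ {F G} → (∀ k → F (suc k) ≡ G (suc k)) → ∀ α → HasDiag F α → HasDiag G α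
HasDiag-ext e α (ip , h) = ip , λ k → trans (h k) (e k)

HasDiag⇒InClass : ∀ e α → All (0 <_) e → HasDiag (at e) α → InClass e α
HasDiag⇒InClass e α pe (ip , h) = ip , diag≡⇒δ≡ α e ip pe h

InClass⇒HasDiag : ∀ e α → InClass e α → HasDiag (at e) α
InClass⇒HasDiag e α (ip , eq) = ip , δ≡⇒diag≡ α e ip eq

HasDiag-bounded : ∀ e α → All (0 <_) e → HasDiag (at e) α → hd α ≤ length e × length α ≤ length e
HasDiag-bounded e [] pe c = z≤n , z≤n
HasDiag-bounded e (a ∷ β) pe c with InClass-bounded e (a ∷ β) (HasDiag⇒InClass e (a ∷ β) pe c)
... | ((_ , p) ∷ _) , l = p , l

HasDiag⇔InClass : ∀ e → All (0 <_) e → ∀ α → HasDiag (at e) α ⇔ InClass e α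
HasDiag⇔InClass e pe α = mk⇔ (HasDiag⇒InClass e α pe) (InClass⇒HasDiag e α)

infix 4 _⟷_

record _⟷_ (P Q : Pred) : Set where
  field
    to        : List ℕ → List ℕ
    from      : List ℕ → List ℕ
    to-resp   : ∀ x → P x → Q (to x)
    from-resp : ∀ y → Q y → P (from y)
    from∘to   : ∀ x → P x → from (to x) ≡ x
    to∘from   : ∀ y → Q y → to (from y) ≡ y

⟷-refl : ∀ {P} → P ⟷ P
⟷-refl = record
  { to = id ; from = id ; to-resp = λ _ p → p ; from-resp = λ _ p → p
  ; from∘to = λ _ _ → refl ; to∘from = λ _ _ → refl }

⟷-sym : ∀ {P Q} → P ⟷ Q → Q ⟷ P
⟷-sym b = record
  { to = from ; from = to ; to-resp = from-resp ; from-resp = to-resp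
  ; from∘to = to∘from ; to∘from = from∘to }
  where open _⟷_ b

⟷-trans : ∀ {P Q R} → P ⟷ Q → Q ⟷ R → P ⟷ R
⟷-trans b c = record
  { to = C.to ∘ B.to ; from = B.from ∘ C.from
  ; to-resp = λ x p → C.to-resp _ (B.to-resp x p)
  ; from-resp = λ z r → B.from-resp _ (C.from-resp z r)
  ; from∘to = λ x p → trans (cong B.from (C.from∘to _ (B.to-resp x p))) (B.from∘to x p)
  ; to∘from = λ z r → trans (cong C.to (B.to∘from _ (C.from-resp z r))) (C.to∘from z r) }
  where
  module B = _⟷_ b
  module C = _⟷_ c

⟷-cong : ∀ {P P' Q Q'} → (∀ x → P x ⇔ P' x) → (∀ x → Q x ⇔ Q' x) → P ⟷ Q → P' ⟷ Q'
⟷-cong eP eQ b = record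
  { to = to ; from = from
  ; to-resp = λ x p → to⇔ (eQ _) (to-resp x (from⇔ (eP x) p))
  ; from-resp = λ y q → to⇔ (eP _) (from-resp y (from⇔ (eQ y) q))
  ; from∘to = λ x p → from∘to x (from⇔ (eP x) p)
  ; to∘from = λ y q → to∘from y (from⇔ (eQ y) q) }
  where open _⟷_ b

⟷-restrict : ∀ {P Q : Pred} (b : P ⟷ Q) (R R' : Pred) →
  (∀ x → P x → R x → R' (_⟷_.to b x)) → (∀ y → Q y → R' y → R (_⟷_.from b y)) →
  (λ x → P x × R x) ⟷ (λ y → Q y × R' y)
⟷-restrict b R R' h1 h2 = record
  { to = to ; from = from
  ; to-resp = λ x (p , r) → to-resp x p , h1 x p r
  ; from-resp = λ y (q , r) → from-resp y q , h2 y q r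
  ; from∘to = λ x (p , _) → from∘to x p
  ; to∘from = λ y (q , _) → to∘from y q }
  where open _⟷_ b

Unique-map : ∀ (h : List ℕ → List ℕ) xs → Unique xs → (∀ x y → x ∈ xs → y ∈ xs → h x ≡ h y → x ≡ y) → Unique (map h xs)
Unique-map h [] [] inj = []
Unique-map h (x ∷ xs) (u ∷ us) inj = go xs u (λ y y∈ → y∈) ∷ Unique-map h xs us (λ a b a∈ b∈ → inj a b (there a∈) (there b∈))
  where
  go : ∀ ys → All (x ≢_) ys → (∀ y → y ∈ ys → y ∈ xs) → All (h x ≢_) (map h ys)
  go [] [] _ = []
  go (y ∷ ys) (n ∷ ns) sub = (λ e → n (inj x y (here refl) (there (sub y (here refl))) e)) ∷ go ys ns
      (λ z z∈ → sub z (there z∈))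

HasSize-⟷ : ∀ {P Q m} → HasSize P m → P ⟷ Q → HasSize Q m
HasSize-⟷ {P} {Q} (xs , u , mem , len) b =
  map to xs ,
  Unique-map to xs u to-injective ,
  (λ y → mk⇔ (to-image y) (λ q → subst (_∈ map to xs) (to∘from y q) (∈-map⁺ to (from⇔ (mem (from y)) (from-resp y q))))) ,
  trans (length-map to xs) len
  where
  open _⟷_ b
  to-injective : ∀ x y → x ∈ xs → y ∈ xs → to x ≡ to y → x ≡ y
  to-injective x y x∈ y∈ e =
    trans (sym (from∘to x (to⇔ (mem x) x∈))) (trans (cong from e) (from∘to y (to⇔ (mem y) y∈)))
  to-image : ∀ y → y ∈ map to xs → Q y
  to-image y y∈ with ∈-map⁻ to y∈
  ... | x , x∈ , refl = to-resp x (to⇔ (mem x) x∈)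

HasSize-cong : ∀ {P Q m} → (∀ x → P x ⇔ Q x) → HasSize P m → HasSize Q m
HasSize-cong e (xs , u , mem , len) = xs , u , (λ x → mk⇔ (λ i → to⇔ (e x) (to⇔ (mem x) i))
    (λ q → from⇔ (mem x) (from⇔ (e x) q))) , len

HasSize-⊎ : ∀ {A B m n} → HasSize A m → HasSize B n → (∀ x → A x → B x → ⊥) → HasSize (λ x → A x ⊎ B x) (m + n)
HasSize-⊎ {A} {B} (xs , u , mem , len) (ys , v , mem' , len') disjoint =
  xs ++ ys ,
  ++⁺ u v (λ { (i , j) → disjoint _ (to⇔ (mem _) i) (to⇔ (mem' _) j) }) ,
  (λ x → mk⇔ (λ i → fwd x (∈-++⁻ xs i)) (bwd x)) ,
  trans (length-++ xs) (cong₂ _+_ len len')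
  where
  fwd : ∀ x → x ∈ xs ⊎ x ∈ ys → A x ⊎ B x
  fwd x (inj₁ i) = inj₁ (to⇔ (mem x) i)
  fwd x (inj₂ j) = inj₂ (to⇔ (mem' x) j)
  bwd : ∀ x → A x ⊎ B x → x ∈ xs ++ ys
  bwd x (inj₁ a) = ∈-++⁺ˡ (from⇔ (mem x) a)
  bwd x (inj₂ b) = ∈-++⁺ʳ xs (from⇔ (mem' x) b)

HasSize-singleton : ∀ c → HasSize (λ x → x ≡ c) 1
HasSize-singleton c = (c ∷ []) , (([] ∷ [])) , (λ x → mk⇔ (λ { (here e) → e ; (there ()) }) (λ e → here e)) , refl

HasSize-decidable : ∀ (P : Pred) → (∀ x → Dec (P x)) → (cands : List (List ℕ)) → (∀ x → P x → x ∈ cands) →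
  ∃ λ m → HasSize P m
HasSize-decidable P P? cands cov =
  length D , D , UDP.deduplicate-! (≡-dec _≟_) (filter P? cands) ,
  (λ x → mk⇔ (λ i → proj₂ (∈-filter⁻ P? {xs = cands} (∈-deduplicate⁻ (≡-dec _≟_) (filter P? cands) i)))
              (λ p → ∈-deduplicate⁺ (≡-dec _≟_) (∈-filter⁺ P? (cov x p) p))) , refl
  where
  D = deduplicate (≡-dec _≟_) (filter P? cands)

boundedLists : ℕ → ℕ → List (List ℕ)
boundedLists h zero = [] ∷ []
boundedLists h (suc ℓ) = [] ∷ concat (map (λ a → map (a ∷_) (boundedLists h ℓ)) (range 1 h))

boundedLists-complete : ∀ h ℓ xs → All (λ x → 1 ≤ x × x ≤ h) xs → length xs ≤ ℓ → xs ∈ boundedLists h ℓ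
boundedLists-complete h zero [] _ _ = here refl
boundedLists-complete h (suc ℓ) [] _ _ = here refl
boundedLists-complete h (suc ℓ) (x ∷ xs) ((p , q) ∷ ps) (s≤s le) =
  there (∈-concat⁺′ (∈-map⁺ (x ∷_) (boundedLists-complete h ℓ xs ps le))
      (∈-map⁺ (λ a → map (a ∷_) (boundedLists h ℓ)) (∈-range1 x h p q)))

InClass? : ∀ e α → Dec (InClass e α)
InClass? e α = ((all? (λ x → 0 <? x) α) ×-dec (linked? (λ x y → y ≤? x) α)) ×-dec (≡-dec _≟_ (δ α) e)

InClass-finite : ∀ e → ∃ λ m → HasSize (InClass e) m
InClass-finite e = HasSize-decidable (InClass e) (InClass? e) (boundedLists (length e) (length e))
  (λ α c → let (b1 , b2) = InClass-bounded e α c in boundedLists-complete (length e) (length e) α b1 b2)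

HasDiag-⟷⇒SameSize : ∀ {d d'} → All (0 <_) d → All (0 <_) d' →
  HasDiag (at d) ⟷ HasDiag (at d') → SameSize (InClass d) (InClass d')
HasDiag-⟷⇒SameSize {d} {d'} pd pd' b with InClass-finite d
... | m , hs = m , hs , HasSize-⟷ hs (⟷-cong (HasDiag⇔InClass d pd) (HasDiag⇔InClass d' pd') b)

-- Deleting a first row or column

-- The diagonal counts left after deleting a first row, or a first column, of length a.
_⊖_ : (ℕ → ℕ) → ℕ → (ℕ → ℕ)
(F ⊖ a) k = F (suc k) ∸ reaches a (suc k)

HasDiag-tail : ∀ F a β → HasDiag F (a ∷ β) → HasDiag (F ⊖ a) β
HasDiag-tail F a β (ip , h) = IsPartition-tail a β ip , λ k → sym
    (trans (cong (_∸ reaches a (suc (suc k))) (sym (h (suc k)))) (m+n∸m≡n (reaches a (suc (suc k))) (diag β (suc k))))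

HasDiag-∷ : ∀ F a β → 0 < a → F 1 ≡ 1 → (∀ k → reaches a (suc k) ≤ F (suc k)) → hd β ≤ a →
  HasDiag (F ⊖ a) β → HasDiag F (a ∷ β)
HasDiag-∷ F a β pa F1 le hb (ip , h) = IsPartition-∷ a β pa hb ip , lv
  where
  lv : ∀ k → diag (a ∷ β) (suc k) ≡ F (suc k)
  lv zero = trans (cong₂ _+_ (reaches-≤ a 1 pa) (diag-0 β)) (sym F1)
  lv (suc k) = trans (cong (reaches a (suc (suc k)) +_) (h k)) (m+[n∸m]≡n (le (suc k)))

firstRow-⟷ : ∀ F a → 0 < a → F 1 ≡ 1 → (∀ k → reaches a (suc k) ≤ F (suc k)) →
  (λ α → HasDiag F α × hd α ≡ a) ⟷ (λ β → HasDiag (F ⊖ a) β × hd β ≤ a)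
firstRow-⟷ F a pa F1 le = record
  { to = tl ; from = a ∷_
  ; to-resp = to-resp ; from-resp = λ β (c , hb) → HasDiag-∷ F a β pa F1 le hb c , refl
  ; from∘to = from∘to ; to∘from = λ _ _ → refl }
  where
  to-resp : ∀ α → HasDiag F α × hd α ≡ a → HasDiag (F ⊖ a) (tl α) × hd (tl α) ≤ a
  to-resp [] (_ , e) = ⊥-elim (<-irrefl e pa)
  to-resp (a' ∷ β) (c , refl) = HasDiag-tail F a' β c , IsPartition-head a' β (proj₁ c)
  from∘to : ∀ α → HasDiag F α × hd α ≡ a → a ∷ tl α ≡ α
  from∘to [] (_ , e) = ⊥-elim (<-irrefl e pa)
  from∘to (a' ∷ β) (_ , refl) = refl

dropFirstColumn : List ℕ → List ℕ
dropFirstColumn [] = []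
dropFirstColumn (zero ∷ β) = []
dropFirstColumn (suc zero ∷ β) = []
dropFirstColumn (suc (suc a) ∷ β) = suc a ∷ dropFirstColumn β

addFirstColumn : ℕ → List ℕ → List ℕ
addFirstColumn L β = map suc β ++ replicate (L ∸ length β) 1

ones-after-1 : ∀ β → IsPartition (1 ∷ β) → β ≡ replicate (length β) 1
ones-after-1 β (p , l) = go β (All.tail p) (All.tail (head-bounds-partition 1 β l))
  where
  go : ∀ β → All (0 <_) β → All (_≤ 1) β → β ≡ replicate (length β) 1
  go [] _ _ = refl
  go (suc zero ∷ β) (_ ∷ ps) (_ ∷ qs) = cong (1 ∷_) (go β ps qs)
  go (suc (suc x) ∷ β) _ (s≤s () ∷ _)

diag-ones : ∀ n k → diag (replicate n 1) (suc k) ≡ reaches n (suc k)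
diag-ones zero k = refl
diag-ones (suc n) zero = cong (1 +_) (diag-0 (replicate n 1))
diag-ones (suc n) (suc k) = diag-ones n k

diag-firstColumn : ∀ α → IsPartition α → ∀ k → diag α (suc k) ≡ reaches (length α) (suc k) + diag (dropFirstColumn α) k
diag-firstColumn [] _ k = refl
diag-firstColumn (zero ∷ β) ((() ∷ _) , _) k
diag-firstColumn (suc zero ∷ β) ip zero = cong (1 +_) (diag-0 β)
diag-firstColumn (suc zero ∷ β) ip (suc k) = trans (trans (cong (λ z → diag z (suc k)) (ones-after-1 β ip))
    (diag-ones (length β) k)) (sym (+-identityʳ _))
diag-firstColumn (suc (suc a) ∷ β) ip zero = cong (1 +_) (diag-0 β)
diag-firstColumn (suc (suc a) ∷ β) ip (suc k) =
  trans (cong (reaches (suc a) (suc k) +_) (diag-firstColumn β (IsPartition-tail _ β ip) k))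
    (trans (sym (+-assoc (reaches (suc a) (suc k)) (reaches (length β) (suc k)) (diag (dropFirstColumn β) k)))
     (trans (cong (_+ diag (dropFirstColumn β) k) (+-comm (reaches (suc a) (suc k)) (reaches (length β) (suc k))))
      (+-assoc (reaches (length β) (suc k)) (reaches (suc a) (suc k)) (diag (dropFirstColumn β) k))))

dropFirstColumn-length : ∀ α → length (dropFirstColumn α) ≤ length α
dropFirstColumn-length [] = z≤n
dropFirstColumn-length (zero ∷ β) = z≤n
dropFirstColumn-length (suc zero ∷ β) = z≤n
dropFirstColumn-length (suc (suc a) ∷ β) = s≤s (dropFirstColumn-length β)

dropFirstColumn-head : ∀ β → hd (dropFirstColumn β) ≤ pred (hd β)
dropFirstColumn-head [] = z≤n
dropFirstColumn-head (zero ∷ β) = z≤n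
dropFirstColumn-head (suc zero ∷ β) = z≤n
dropFirstColumn-head (suc (suc a) ∷ β) = ≤-refl

dropFirstColumn-IsPartition : ∀ α → IsPartition α → IsPartition (dropFirstColumn α)
dropFirstColumn-IsPartition [] _ = [] , []
dropFirstColumn-IsPartition (zero ∷ β) _ = [] , []
dropFirstColumn-IsPartition (suc zero ∷ β) _ = [] , []
dropFirstColumn-IsPartition (suc (suc a) ∷ β) ip = IsPartition-∷ (suc a) (dropFirstColumn β) (s≤s z≤n)
    (≤-trans (dropFirstColumn-head β) (pred-mono-≤ (IsPartition-head _ β ip)))
    (dropFirstColumn-IsPartition β (IsPartition-tail _ β ip))

ones-IsPartition : ∀ n → IsPartition (replicate n 1)
ones-IsPartition zero = [] , []
ones-IsPartition (suc zero) = (s≤s z≤n ∷ []) , [-]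
ones-IsPartition (suc (suc n)) = IsPartition-∷ 1 (replicate (suc n) 1) (s≤s z≤n) ≤-refl (ones-IsPartition (suc n))

ones-head : ∀ n → hd (replicate n 1) ≤ 1
ones-head zero = z≤n
ones-head (suc n) = ≤-refl

addFirstColumn-IsPartition : ∀ L β → IsPartition β → length β ≤ L → IsPartition (addFirstColumn L β)
addFirstColumn-IsPartition L [] _ _ = ones-IsPartition L
addFirstColumn-IsPartition (suc L) (b ∷ β) ip (s≤s le) = IsPartition-∷ (suc b) (addFirstColumn L β) (s≤s z≤n)
    (hb β (IsPartition-head b β ip)) (addFirstColumn-IsPartition L β (IsPartition-tail b β ip) le)
  where
  hb : ∀ β → hd β ≤ b → hd (addFirstColumn L β) ≤ suc b
  hb [] _ = ≤-trans (ones-head L) (s≤s z≤n)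
  hb (c ∷ β) p = s≤s p

addFirstColumn-length : ∀ L β → length β ≤ L → length (addFirstColumn L β) ≡ L
addFirstColumn-length L β le = trans (length-++ (map suc β))
    (trans (cong₂ _+_ (length-map suc β) (length-replicate (L ∸ length β))) (m+[n∸m]≡n le))

dropFirstColumn-ones : ∀ n → dropFirstColumn (replicate n 1) ≡ []
dropFirstColumn-ones zero = refl
dropFirstColumn-ones (suc n) = refl

dropFirstColumn-map-suc : ∀ j β → All (0 <_) β → dropFirstColumn (map suc β ++ replicate j 1) ≡ β
dropFirstColumn-map-suc j [] _ = dropFirstColumn-ones j
dropFirstColumn-map-suc j (suc b ∷ β) (_ ∷ p) = cong (suc b ∷_) (dropFirstColumn-map-suc j β p)

dropFirstColumn-addFirstColumn : ∀ L β → All (0 <_) β → dropFirstColumn (addFirstColumn L β) ≡ β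
dropFirstColumn-addFirstColumn L β p = dropFirstColumn-map-suc (L ∸ length β) β p

addFirstColumn-dropFirstColumn : ∀ α → IsPartition α → addFirstColumn (length α) (dropFirstColumn α) ≡ α
addFirstColumn-dropFirstColumn [] _ = refl
addFirstColumn-dropFirstColumn (zero ∷ β) ((() ∷ _) , _)
addFirstColumn-dropFirstColumn (suc zero ∷ β) ip = cong (1 ∷_) (sym (ones-after-1 β ip))
addFirstColumn-dropFirstColumn (suc (suc a) ∷ β) ip = cong (suc (suc a) ∷_)
    (addFirstColumn-dropFirstColumn β (IsPartition-tail _ β ip))

firstColumn-⟷ : ∀ F L → 0 < L → F 1 ≡ 1 → (∀ k → reaches L (suc k) ≤ F (suc k)) →
  (λ α → HasDiag F α × length α ≡ L) ⟷ (λ β → HasDiag (F ⊖ L) β × length β ≤ L)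
firstColumn-⟷ F L pL F1 le = record
  { to = dropFirstColumn ; from = addFirstColumn L
  ; to-resp = to-resp ; from-resp = from-resp
  ; from∘to = λ { α ((ip , _) , refl) → addFirstColumn-dropFirstColumn α ip }
  ; to∘from = λ β ((ip , _) , _) → dropFirstColumn-addFirstColumn L β (proj₁ ip) }
  where
  to-resp : ∀ α → HasDiag F α × length α ≡ L → HasDiag (F ⊖ L) (dropFirstColumn α) × length (dropFirstColumn α) ≤ L
  to-resp α ((ip , h) , refl) = (dropFirstColumn-IsPartition α ip , λ k → sym
      (trans (cong (_∸ reaches (length α) (suc (suc k))) (trans (sym (h (suc k))) (diag-firstColumn α ip (suc k))))
      (m+n∸m≡n (reaches (length α) (suc (suc k))) (diag (dropFirstColumn α) (suc k))))) , dropFirstColumn-length α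
  from-resp : ∀ β → HasDiag (F ⊖ L) β × length β ≤ L → HasDiag F (addFirstColumn L β) × length (addFirstColumn L β) ≡ L
  from-resp β ((ip , h) , lb) = (addFirstColumn-IsPartition L β ip lb , lv) , addFirstColumn-length L β lb
    where
    α = addFirstColumn L β
    ipα = addFirstColumn-IsPartition L β ip lb
    base : ∀ k → diag α (suc k) ≡ reaches L (suc k) + diag β k
    base k = trans (diag-firstColumn α ipα k)
        (cong₂ (λ x y → reaches x (suc k) + diag y k) (addFirstColumn-length L β lb)
        (dropFirstColumn-addFirstColumn L β (proj₁ ip)))
    lv : ∀ k → diag α (suc k) ≡ F (suc k)
    lv zero = trans (base 0) (trans (cong₂ _+_ (reaches-≤ L 1 pL) (diag-0 β)) (sym F1))
    lv (suc k) = trans (base (suc k)) (trans (cong (reaches L (suc (suc k)) +_) (h k)) (m+[n∸m]≡n (le (suc k))))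

HasDiag-[]⇒[] : ∀ α → HasDiag (at []) α → α ≡ []
HasDiag-[]⇒[] [] _ = refl
HasDiag-[]⇒[] (a ∷ β) (((pa ∷ _) , _) , h) = ⊥-elim (0≢1+n
    (sym (trans (cong₂ _+_ (sym (reaches-≤ a 1 pa)) (sym (diag-0 β))) (h 0))))

HasDiag-[] : ∀ α → HasDiag (at []) α ⇔ (α ≡ [])
HasDiag-[] α = mk⇔ (HasDiag-[]⇒[] α) (λ { refl → ([] , []) , λ k → refl })

count-[] : HasSize (HasDiag (at [])) 1
count-[] = HasSize-cong (λ α → mk⇔ (from⇔ (HasDiag-[] α)) (to⇔ (HasDiag-[] α))) (HasSize-singleton [])

downBlocks-suc : ∀ q s → downBlocks (suc q) s ≡ map suc (downBlocks q (s ∘ suc)) ++ replicate (s 1) 1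
downBlocks-suc zero s = ++-identityʳ _
downBlocks-suc (suc q) s =
  trans (cong (replicate (s (suc (suc q))) (suc (suc q)) ++_) (downBlocks-suc q s))
  (trans (sym (++-assoc (replicate (s (suc (suc q))) (suc (suc q))) _ _))
   (cong (_++ replicate (s 1) 1)
     (trans (cong (_++ map suc (downBlocks q (s ∘ suc))) (sym (map-replicate suc (s (suc (suc q))) (suc q))))
            (sym (map-++ suc (replicate (s (suc (suc q))) (suc q)) (downBlocks q (s ∘ suc)))))))

stair-suc : ∀ q → stair (suc q) ≡ 1 ∷ map suc (stair q)
stair-suc q = range1-suc q

dSeq-suc : ∀ q s → dSeq (suc q) s ≡ 1 ∷ (map suc (dSeq q (s ∘ suc)) ++ replicate (s 1) 1)
dSeq-suc q s =
  trans (cong₂ _++_ (stair-suc q) (downBlocks-suc q s))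
   (cong (1 ∷_) (trans (sym (++-assoc (map suc (stair q)) (map suc (downBlocks q (s ∘ suc))) (replicate (s 1) 1)))
     (cong (_++ replicate (s 1) 1) (sym (map-++ suc (stair q) (downBlocks q (s ∘ suc)))))))

All-positive-map-suc : ∀ xs → All (0 <_) (map suc xs)
All-positive-map-suc [] = []
All-positive-map-suc (x ∷ xs) = s≤s z≤n ∷ All-positive-map-suc xs

dSeq-positive : ∀ q s → All (0 <_) (dSeq q s)
dSeq-positive zero s = []
dSeq-positive (suc q) s rewrite dSeq-suc q s = s≤s z≤n ∷ Allₚ.++⁺ (All-positive-map-suc _) (Allₚ.replicate⁺ (s 1) (s≤s z≤n))

length-stair : ∀ q → length (stair q) ≡ q
length-stair q = length-range1 q

length-dSeq : ∀ q s → q ≤ length (dSeq q s)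
length-dSeq q s = subst (_≤ length (dSeq q s)) (length-stair q)
    (subst (length (stair q) ≤_) (sym (length-++ (stair q))) (m≤m+n _ _))

at-stair : ∀ m k → k < m → at (stair m) (suc k) ≡ suc k
at-stair (suc m) zero _ = cong (λ z → at z 1) (stair-suc m)
at-stair (suc m) (suc k) (s≤s p) = trans (cong (λ z → at z (suc (suc k))) (stair-suc m))
  (trans (at-∷ 1 (map suc (stair m)) k) (trans (at-map suc (stair m) k (subst (k <_) (sym (length-stair m)) p))
      (cong suc (at-stair m k p))))

stair-positive : ∀ m → All (0 <_) (stair m)
stair-positive zero = []
stair-positive (suc m) = subst (All (0 <_)) (sym (stair-suc m)) (s≤s z≤n ∷ All-positive-map-suc (stair m))

stair-∷ʳ : ∀ m → stair (suc m) ≡ stair m ++ (suc m ∷ [])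
stair-∷ʳ m = trans (cong (map (1 +_)) (sym (upTo-∷ʳ m))) (map-++ (1 +_) (upTo m) (m ∷ []))

downBlocks-positive : ∀ k s → All (0 <_) (downBlocks k s)
downBlocks-positive zero s = []
downBlocks-positive (suc k) s = Allₚ.++⁺ (Allₚ.replicate⁺ (s (suc k)) (s≤s z≤n)) (downBlocks-positive k s)

stair++downBlocks-positive : ∀ q k s → All (0 <_) (stair q ++ downBlocks k s)
stair++downBlocks-positive q k s = Allₚ.++⁺ (stair-positive q) (downBlocks-positive k s)

downBlocks-two : ∀ k s t → s (suc k) ≡ suc (suc t) → downBlocks (suc k) s ≡ suc k ∷ suc k ∷ (replicate t (suc k) ++ downBlocks k s)
downBlocks-two k s t e = cong (λ n → replicate n (suc k) ++ downBlocks k s) e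

≥2⇒suc-suc : ∀ n → 2 ≤ n → Σ ℕ λ t → n ≡ suc (suc t)
≥2⇒suc-suc (suc (suc t)) _ = t , refl
≥2⇒suc-suc (suc zero) (s≤s ())

reaches-length≤at : ∀ e k → All (0 <_) e → reaches (length e) (suc k) ≤ at e (suc k)
reaches-length≤at e k pe with suc k ≤? length e
... | yes p = subst (_≤ at e (suc k)) (sym (reaches-≤ (length e) (suc k) p)) (at-positive e k pe p)
... | no np = subst (_≤ at e (suc k)) (sym (reaches-< (length e) (suc k) (≰⇒> np))) z≤n

-- (1, e'+1, 1^r): deleting a first row or a first column of length |cone e' r| leaves e'.
cone : List ℕ → ℕ → List ℕ
cone e' r = 1 ∷ (map suc e' ++ replicate r 1)

cone-length : ∀ e' r → length (cone e' r) ≡ suc (length e' + r)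
cone-length e' r = cong suc (trans (length-++ (map suc e')) (cong₂ _+_ (length-map suc e') (length-replicate r)))

cone-positive : ∀ e' r → All (0 <_) (cone e' r)
cone-positive e' r = s≤s z≤n ∷ Allₚ.++⁺ (All-positive-map-suc e') (Allₚ.replicate⁺ r (s≤s z≤n))

cone-⊖ : ∀ e' r k → (at (cone e' r) ⊖ length (cone e' r)) (suc k) ≡ at e' (suc k)
cone-⊖ e' r k = trans (cong₂ _∸_ (at-∷ 1 (map suc e' ++ replicate r 1) k)
    (cong (λ z → reaches z (suc k)) (suc-injective (cone-length e' r)))) (go k)
  where
  T = map suc e' ++ replicate r 1
  go : ∀ k → at T (suc k) ∸ reaches (length e' + r) (suc k) ≡ at e' (suc k)
  go k with k <? length e'
  ... | yes p = trans (cong₂ _∸_ (trans (at-++ˡ (map suc e') (replicate r 1) k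
      (subst (k <_) (sym (length-map suc e')) p)) (at-map suc e' k p))
                                (reaches-≤ (length e' + r) (suc k) (≤-trans p (m≤m+n (length e') r)))) refl
  ... | no np = trans (cong (λ z → at T (suc z) ∸ reaches (length e' + r) (suc z)) (sym eqk))
      (trans (goB (k ∸ length e')) (sym (at-beyond-length e' k le)))
    where
    le = ≮⇒≥ np
    eqk = m+[n∸m]≡n le
    go2 : ∀ j → at (replicate r 1) (suc j) ∸ reaches (length e' + r) (suc (length e' + j)) ≡ 0
    go2 j with j <? r
    ... | yes q = subst (λ w → at (replicate r 1) (suc j) ∸ w ≡ 0)
        (sym (reaches-≤ (length e' + r) (suc (length e' + j))
        (subst (_≤ length e' + r) (+-suc (length e') j) (+-monoʳ-≤ (length e') q))))
                    (cong (_∸ 1) (at-replicate r 1 j q))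
    ... | no nq = subst (λ w → w ∸ reaches (length e' + r) (suc (length e' + j)) ≡ 0)
        (sym (at-beyond-length (replicate r 1) j (subst (_≤ j) (sym (length-replicate r)) (≮⇒≥ nq))))
        (0∸n≡0 (reaches (length e' + r) (suc (length e' + j))))
    goB : ∀ j → at T (suc (length e' + j)) ∸ reaches (length e' + r) (suc (length e' + j)) ≡ 0
    goB j = trans (cong (_∸ reaches (length e' + r) (suc (length e' + j)))
        (trans (cong (λ z → at T (suc (z + j))) (sym (length-map suc e'))) (at-++ʳ (map suc e') (replicate r 1) j))) (go2 j)

at-cone-tail : ∀ e' r j → j < r → at (cone e' r) (suc (suc (length e' + j))) ≡ 1
at-cone-tail e' r j lt = trans (at-∷ 1 (map suc e' ++ replicate r 1) (length e' + j))
    (trans (cong (λ z → at (map suc e' ++ replicate r 1) (suc (z + j))) (sym (length-map suc e')))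
    (trans (at-++ʳ (map suc e') (replicate r 1) j) (at-replicate r 1 j lt)))

-- Makes the last two entries of the cone ≤ 1 and = 1, which forces a first row or a first
-- column of full length.
PeelCondition : List ℕ → ℕ → Set
PeelCondition e' r = (e' ≡ [] × 1 ≤ r) ⊎ (2 ≤ r)

record PeelData (e' : List ℕ) (r : ℕ) : Set where
  field
    M : ℕ
    LM : length (cone e' r) ≡ suc (suc M)
    atL : at (cone e' r) (suc (suc M)) ≡ 1
    atL1 : at (cone e' r) (suc M) ≤ 1

peelData : ∀ e' r → PeelCondition e' r → PeelData e' r
peelData .[] (suc r') (inj₁ (refl , _)) = record { M = r' ; LM = cone-length [] (suc r') ; atL = at-replicate
    (suc (suc r')) 1 (suc r') ≤-refl ; atL1 = at-ones-≤1 (suc (suc r')) (suc r') }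
peelData e' (suc zero) (inj₂ (s≤s ()))
peelData e' (suc (suc r'')) (inj₂ _) = record
        { M = length e' + suc r''
        ; LM = trans (cone-length e' (suc (suc r''))) (cong suc (+-suc (length e') (suc r'')))
        ; atL = at-cone-tail e' (suc (suc r'')) (suc r'') ≤-refl
        ; atL1 = ≤-reflexive (subst (λ z → at (cone e' (suc (suc r''))) (suc z) ≡ 1) (sym (+-suc (length e') r''))
            (at-cone-tail e' (suc (suc r'')) r'' (n≤1+n _))) }

module Peel (e' : List ℕ) (r : ℕ) (pe' : All (0 <_) e') where
  e = cone e' r
  L = length e
  F = at e
  pe = cone-positive e' r

  cone-firstRow-residue : ∀ β → (HasDiag (F ⊖ L) β × hd β ≤ L) ⇔ HasDiag (at e') β
  cone-firstRow-residue β = mk⇔ (λ (c , _) → HasDiag-ext {F ⊖ L} {at e'} (cone-⊖ e' r) β c)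
                   (λ c → HasDiag-ext {at e'} {F ⊖ L} (λ k → sym (cone-⊖ e' r k)) β c ,
                          ≤-trans (proj₁ (HasDiag-bounded e' β pe' c))
                              (≤-trans (n≤1+n _)
                              (≤-trans (s≤s (m≤m+n (length e') r)) (≤-reflexive (sym (cone-length e' r))))))

  cone-firstColumn-residue : ∀ β → (HasDiag (F ⊖ L) β × length β ≤ L) ⇔ HasDiag (at e') β
  cone-firstColumn-residue β = mk⇔ (λ (c , _) → HasDiag-ext {F ⊖ L} {at e'} (cone-⊖ e' r) β c)
                   (λ c → HasDiag-ext {at e'} {F ⊖ L} (λ k → sym (cone-⊖ e' r k)) β c ,
                          ≤-trans (proj₂ (HasDiag-bounded e' β pe' c))
                              (≤-trans (n≤1+n _)
                              (≤-trans (s≤s (m≤m+n (length e') r)) (≤-reflexive (sym (cone-length e' r))))))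

  cone-firstRow-⟷ : (λ α → HasDiag F α × hd α ≡ L) ⟷ HasDiag (at e')
  cone-firstRow-⟷ = ⟷-cong (λ _ → mk⇔ id id) cone-firstRow-residue
      (firstRow-⟷ F L (s≤s z≤n) refl (λ k → reaches-length≤at e k pe))

  cone-firstColumn-⟷ : (λ α → HasDiag F α × length α ≡ L) ⟷ HasDiag (at e')
  cone-firstColumn-⟷ = ⟷-cong (λ _ → mk⇔ id id) cone-firstColumn-residue
      (firstColumn-⟷ F L (s≤s z≤n) refl (λ k → reaches-length≤at e k pe))

  module _ (cd : PeelData e' r) where
    open PeelData cd

    firstRow⊎firstColumn : ∀ α → HasDiag F α → (HasDiag F α × hd α ≡ L) ⊎ (HasDiag F α × length α ≡ L)
    firstRow⊎firstColumn α c@(ip , h) with corner-in-first-row-or-column α (suc M) ip (s≤s z≤n)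
        (subst (1 ≤_) (sym (h (suc M))) (subst (1 ≤_) (sym atL) ≤-refl)) (subst (_≤ 1) (sym (h M)) atL1)
    ... | inj₁ p = inj₁ (c , ≤-antisym (proj₁ (HasDiag-bounded e α pe c)) (subst (_≤ hd α) (sym LM) p))
    ... | inj₂ p = inj₂ (c , ≤-antisym (proj₂ (HasDiag-bounded e α pe c)) (subst (_≤ length α) (sym LM) p))

    firstRow-disjoint-firstColumn : ∀ α → (HasDiag F α × hd α ≡ L) → (HasDiag F α × length α ≡ L) → ⊥
    firstRow-disjoint-firstColumn [] (_ , e1) _ = 0≢1+n (trans e1 LM)
    firstRow-disjoint-firstColumn (a ∷ β) ((ip , h) , e1) (_ , e2) = <-irrefl refl
        (≤-trans two (≤-reflexive (trans (h (suc M)) atL)))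
      where
      lb : suc M ≤ length β
      lb = ≤-reflexive (sym (suc-injective (trans e2 LM)))
      lv : diag (a ∷ β) (suc (suc M)) ≡ 1 + diag β (suc M)
      lv = cong (_+ diag β (suc M)) (reaches-≤ a (suc (suc M)) (≤-reflexive (sym (trans e1 LM))))
      two : 2 ≤ diag (a ∷ β) (suc (suc M))
      two = subst (2 ≤_) (sym lv) (s≤s (diag-row β M (All.tail (proj₁ ip)) lb))

    count-cone : ∀ m → HasSize (HasDiag (at e')) m → HasSize (HasDiag F) (m + m)
    count-cone m hs = HasSize-cong (λ α → mk⇔ (λ { (inj₁ (c , _)) → c ; (inj₂ (c , _)) → c }) (firstRow⊎firstColumn α))
                        (HasSize-⊎ (HasSize-⟷ hs (⟷-sym cone-firstRow-⟷))
                            (HasSize-⟷ hs (⟷-sym cone-firstColumn-⟷)) firstRow-disjoint-firstColumn)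

2^-suc : ∀ q → 2 ^ suc q ≡ 2 ^ q + 2 ^ q
2^-suc q = cong (2 ^ q +_) (+-identityʳ (2 ^ q))

peelCondition-dSeq : ∀ q s → (∀ i → 1 ≤ i → i < suc q → 2 ≤ s i) → (1 ≤ suc q → 1 ≤ s (suc q)) →
  PeelCondition (dSeq q (s ∘ suc)) (s 1)
peelCondition-dSeq zero s h1 h2 = inj₁ (refl , h2 (s≤s z≤n))
peelCondition-dSeq (suc q) s h1 h2 = inj₂ (h1 1 (s≤s z≤n) (s≤s (s≤s z≤n)))

count-dSeq : ∀ q s → (∀ i → 1 ≤ i → i < q → 2 ≤ s i) → (1 ≤ q → 1 ≤ s q) → HasSize (HasDiag (at (dSeq q s))) (2 ^ q)
count-dSeq zero s _ _ = count-[]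
count-dSeq (suc q) s h1 h2 = subst₂ (λ P m → HasSize P m) (cong (HasDiag ∘ at) (sym (dSeq-suc q s))) (sym (2^-suc q)) res
  where
  e' = dSeq q (s ∘ suc)
  ih : HasSize (HasDiag (at e')) (2 ^ q)
  ih = count-dSeq q (s ∘ suc) (λ i p1 p2 → h1 (suc i) (s≤s z≤n) (s≤s p2)) (λ p → h2 (s≤s z≤n))
  cond : PeelCondition e' (s 1)
  cond = peelCondition-dSeq q s h1 h2
  res : HasSize (HasDiag (at (cone e' (s 1)))) (2 ^ q + 2 ^ q)
  res = Peel.count-cone e' (s 1) (dSeq-positive q (s ∘ suc)) (peelData e' (s 1) cond) (2 ^ q) ih

peelCondition-r : ∀ e' r → PeelCondition e' r → 1 ≤ r
peelCondition-r e' r (inj₁ (_ , p)) = p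
peelCondition-r e' r (inj₂ p) = ≤-trans (s≤s z≤n) p

head-forced : ∀ e' r q → All (0 <_) e' → q ≤ length e' → (PeelCondition e' r ⊎ (e' ≡ [] × r ≡ 0)) →
  ∀ α → HasDiag (at (cone e' r)) α → length α ≡ suc q → hd α ≡ length (cone e' r)
head-forced e' r q pe' ql (inj₁ cd) α c l with Peel.firstRow⊎firstColumn e' r pe' (peelData e' r cd) α c
... | inj₁ (_ , h) = h
... | inj₂ (_ , l') = ⊥-elim (<-irrefl refl p)
  where
  eq : q ≡ length e' + r
  eq = suc-injective (trans (sym l) (trans l' (cone-length e' r)))
  p : suc (length e') ≤ length e'
  p = ≤-trans (≤-reflexive (+-comm 1 (length e')))
      (≤-trans (+-monoʳ-≤ (length e') (peelCondition-r e' r cd)) (≤-trans (≤-reflexive (sym eq)) ql))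
head-forced .[] .0 q pe' ql (inj₂ (refl , refl)) [] c ()
head-forced .[] .0 q pe' ql (inj₂ (refl , refl)) (a ∷ β) c l = ≤-antisym (proj₁
    (HasDiag-bounded (1 ∷ []) (a ∷ β) (s≤s z≤n ∷ []) c)) (All.head (proj₁ (proj₁ c)))

count-parts-step : ∀ e' r q → All (0 <_) e' → q ≤ length e' → (PeelCondition e' r ⊎ (e' ≡ [] × r ≡ 0)) →
  HasSize (λ β → HasDiag (at e') β × length β ≡ q) 1 → HasSize (λ α → HasDiag (at (cone e' r)) α × length α ≡ suc q) 1
count-parts-step e' r q pe' ql peelCondition-or-trivial ih = HasSize-cong iff (HasSize-⟷ ih (⟷-sym b))
  where
  L = length (cone e' r)
  b : (λ α → (HasDiag (at (cone e' r)) α × hd α ≡ L) × length α ≡ suc q) ⟷ (λ β → HasDiag (at e') β × length β ≡ q)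
  b = ⟷-restrict (Peel.cone-firstRow-⟷ e' r pe') (λ α → length α ≡ suc q) (λ β → length β ≡ q)
        (λ { [] _ () ; (a ∷ β) _ l → suc-injective l }) (λ β _ l → cong suc l)
  iff : ∀ α → ((HasDiag (at (cone e' r)) α × hd α ≡ L) × length α ≡ suc q) ⇔ (HasDiag (at (cone e' r)) α × length α ≡ suc q)
  iff α = mk⇔ (λ ((c , _) , l) → c , l) (λ (c , l) → (c , head-forced e' r q pe' ql peelCondition-or-trivial α c l) , l)

count-dSeq-parts : ∀ q s → (∀ i → 1 ≤ i → i < q → 2 ≤ s i) → HasSize (λ α → HasDiag (at (dSeq q s)) α × length α ≡ q) 1
count-dSeq-parts zero s _ = HasSize-cong
    (λ α → mk⇔ (λ { refl → (([] , []) , (λ k → refl)) , refl }) (λ (c , _) → HasDiag-[]⇒[] α c)) (HasSize-singleton [])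
count-dSeq-parts (suc q) s h1 = subst (λ d → HasSize (λ α → HasDiag (at d) α × length α ≡ suc q) 1) (sym (dSeq-suc q s))
  (count-parts-step (dSeq q (s ∘ suc)) (s 1) q (dSeq-positive q (s ∘ suc)) (length-dSeq q (s ∘ suc))
      (peelCondition-or-trivial q s h1)
    (count-dSeq-parts q (s ∘ suc) (λ i p1 p2 → h1 (suc i) (s≤s z≤n) (s≤s p2))))
  where
  peelCondition-or-trivial : ∀ q s → (∀ i → 1 ≤ i → i < suc q → 2 ≤ s i) →
    PeelCondition (dSeq q (s ∘ suc)) (s 1) ⊎ (dSeq q (s ∘ suc) ≡ [] × s 1 ≡ 0)
  peelCondition-or-trivial zero s h1 with s 1
  ... | zero = inj₂ (refl , refl)
  ... | suc r = inj₁ (inj₁ (refl , s≤s z≤n))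
  peelCondition-or-trivial (suc q) s h1 = inj₁ (inj₂ (h1 1 (s≤s z≤n) (s≤s (s≤s z≤n))))

cone-shift-⊖ : ∀ x y k → (at (1 ∷ (map suc x ++ y)) ⊖ suc (length x)) (suc k) ≡ at (x ++ y) (suc k)
cone-shift-⊖ x y k with k <? length x
... | yes p = trans (cong₂ _∸_ (trans (at-++ˡ (map suc x) y k (subst (k <_) (sym (length-map suc x)) p))
    (at-map suc x k p)) (reaches-≤ (length x) (suc k) p))
                    (sym (at-++ˡ x y k p))
... | no np = trans (cong₂ _∸_ (trans (cong (λ z → at (map suc x ++ y) (suc z)) (sym eqk))
    (trans (cong (λ z → at (map suc x ++ y) (suc (z + (k ∸ length x)))) (sym (length-map suc x)))
    (at-++ʳ (map suc x) y (k ∸ length x)))) (reaches-< (length x) (suc k) (s≤s (≮⇒≥ np))))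
                    (sym (trans (cong (λ z → at (x ++ y) (suc z)) (sym eqk)) (at-++ʳ x y (k ∸ length x))))
  where eqk = m+[n∸m]≡n (≮⇒≥ np)

count-stair : ∀ m → HasSize (HasDiag (at (stair m))) 1
count-stair zero = count-[]
count-stair (suc m) = subst (λ d → HasSize (HasDiag (at d)) 1) (sym eqd)
    (HasSize-cong iff (HasSize-⟷ (count-stair m) (⟷-sym (Peel.cone-firstRow-⟷ (stair m) 0 (stair-positive m)))))
  where
  eqd : stair (suc m) ≡ cone (stair m) 0
  eqd = trans (stair-suc m) (cong (1 ∷_) (sym (++-identityʳ (map suc (stair m)))))
  e = cone (stair m) 0
  iff : ∀ α → (HasDiag (at e) α × hd α ≡ length e) ⇔ HasDiag (at e) α
  iff α = mk⇔ proj₁ (λ c → c , ≤-antisym (proj₁ (HasDiag-bounded e α (cone-positive (stair m) 0) c))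
     (subst (_≤ hd α) (sym lenE) (diag-full⇒≤hd α m
         (trans (proj₂ c m) (trans (cong (λ z → at z (suc m)) (sym eqd)) (at-stair (suc m) m ≤-refl))))))
    where
    lenE : length e ≡ suc m
    lenE = trans (cone-length (stair m) 0) (cong suc (trans (+-identityʳ _) (length-stair m)))

stairOne : ℕ → List ℕ
stairOne p = stair p ++ (1 ∷ [])

stairOne-positive : ∀ p → All (0 <_) (stairOne p)
stairOne-positive p = Allₚ.++⁺ (stair-positive p) (s≤s z≤n ∷ [])

count-stairOne : ∀ p → HasSize (HasDiag (at (stairOne p))) (suc p)
count-stairOne zero = count-stair 1
count-stairOne (suc p) = subst (λ d → HasSize (HasDiag (at d)) (suc (suc p))) (sym eqd) res
  where
  x = stair p
  e = cone x 1
  eqd : stairOne (suc p) ≡ e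
  eqd = cong (_++ (1 ∷ [])) (stair-suc p)
  pe = cone-positive x 1
  F = at e
  lenE : length e ≡ suc (suc p)
  lenE = trans (cone-length x 1) (cong suc (trans (+-comm (length x) 1) (cong suc (length-stair p))))
  longRow-⟷ : (λ α → HasDiag F α × hd α ≡ length e) ⟷ HasDiag (at x)
  longRow-⟷ = Peel.cone-firstRow-⟷ x 1 (stair-positive p)
  shortRow-residue-⟷ : (λ α → HasDiag F α × hd α ≡ suc p) ⟷ (λ β → HasDiag (F ⊖ suc p) β × hd β ≤ suc p)
  shortRow-residue-⟷ = firstRow-⟷ F (suc p) (s≤s z≤n) refl
      (λ k → ≤-trans (reaches-mono (suc p) (length e) (suc k) (≤-trans (n≤1+n _) (≤-reflexive (sym lenE))))
      (reaches-length≤at e k pe))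
  shortRow-residue : ∀ k → (F ⊖ suc p) (suc k) ≡ at (stairOne p) (suc k)
  shortRow-residue k = subst (λ w → (F ⊖ suc w) (suc k) ≡ at (stairOne p) (suc k)) (length-stair p)
      (cone-shift-⊖ x (1 ∷ []) k)
  length-stairOne : length (stairOne p) ≡ suc p
  length-stairOne = trans (length-++ (stair p)) (trans (cong (_+ 1) (length-stair p)) (+-comm p 1))
  shortRow-⟷ : (λ α → HasDiag F α × hd α ≡ suc p) ⟷ HasDiag (at (stairOne p))
  shortRow-⟷ = ⟷-cong (λ _ → mk⇔ id id)
         (λ β → mk⇔ (λ (c , _) → HasDiag-ext {F ⊖ suc p} {at (stairOne p)} shortRow-residue β c)
                    (λ c → HasDiag-ext {at (stairOne p)} {F ⊖ suc p} (λ k → sym (shortRow-residue k)) β c , subst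
                        (hd β ≤_) length-stairOne (proj₁ (HasDiag-bounded (stairOne p) β (stairOne-positive p) c))))
         shortRow-residue-⟷
  at-cone-full : at e (suc p) ≡ suc p
  at-cone-full = trans (cong (λ z → at z (suc p)) (sym eqd))
      (trans (at-++ˡ (stair (suc p)) (1 ∷ []) p (subst (p <_) (sym (length-stair (suc p))) ≤-refl))
      (at-stair (suc p) p ≤-refl))
  head-cases : ∀ α → HasDiag F α → (HasDiag F α × hd α ≡ length e) ⊎ (HasDiag F α × hd α ≡ suc p)
  head-cases α c with hd α ≟ suc (suc p)
  ... | yes h = inj₁ (c , trans h (sym lenE))
  ... | no nh = inj₂ (c , ≤-antisym (≤-pred (≤∧≢⇒< (subst (hd α ≤_) lenE (proj₁ (HasDiag-bounded e α pe c))) nh))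
      (diag-full⇒≤hd α p (trans (proj₂ c p) at-cone-full)))
  heads-differ : ∀ α → (HasDiag F α × hd α ≡ length e) → (HasDiag F α × hd α ≡ suc p) → ⊥
  heads-differ α (_ , h1) (_ , h2) = 1+n≢n (trans (sym lenE) (trans (sym h1) h2))
  res : HasSize (HasDiag F) (suc (suc p))
  res = HasSize-cong (λ α → mk⇔ (λ { (inj₁ (c , _)) → c ; (inj₂ (c , _)) → c }) (head-cases α))
          (HasSize-⊎ (HasSize-⟷ (count-stair p) (⟷-sym longRow-⟷))
              (HasSize-⟷ (count-stairOne p) (⟷-sym shortRow-⟷)) heads-differ)

stairOne-nonempty : ∀ p → [] ≡ stairOne p → ⊥
stairOne-nonempty zero ()
stairOne-nonempty (suc p) e with trans e (cong (_++ (1 ∷ [])) (stair-suc p))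
... | ()

InClass-stairOne-sum : ∀ p α → InClass (stairOne p) α → 0 < sum α
InClass-stairOne-sum p [] (_ , eq) = ⊥-elim (stairOne-nonempty p eq)
InClass-stairOne-sum p (a ∷ β) ((pa ∷ _ , _) , _) = ≤-trans pa (m≤m+n a (sum β))

every-size-occurs : (m : ℕ) → 0 < m → Σ ℕ λ n' → Σ (List ℕ) λ α → 0 < n' × IsPartitionOf n' α × HasSize (InClass (δ α)) m
every-size-occurs (suc p) _ with HasSize-cong (HasDiag⇔InClass (stairOne p) (stairOne-positive p)) (count-stairOne p)
... | hs@([] , _ , _ , ())
... | hs@((α ∷ xs) , u , mem , len) = sum α , α , pos , (proj₁ inα , refl) , subst (λ d → HasSize (InClass d) (suc p))
    (sym (proj₂ inα)) hs
  where
  inα : InClass (stairOne p) α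
  inα = to⇔ (mem α) (here refl)
  pos : 0 < sum α
  pos = InClass-stairOne-sum p α inα

-- The product of the (b_i + 1)

<ᵇ-+ : ∀ n i m → ((n + i) <ᵇ (n + m)) ≡ (i <ᵇ m)
<ᵇ-+ zero i m = refl
<ᵇ-+ (suc n) i m = <ᵇ-+ n i m

bEntry-∷ : ∀ x zs i → 1 ≤ i → 1 ≤ length zs → bEntry (x ∷ zs) (suc i) ≡ bEntry zs i
bEntry-∷ x zs (suc i) _ lz with suc i <ᵇ length zs
... | true = cong₂ _∸_ (at-∷ x zs i) (at-∷ x zs (suc i))
... | false with zs | lz
...   | z ∷ zs' | _ = at-∷ x (z ∷ zs') (length zs')

bProduct1-∷∷ : ∀ x y r → bProduct 1 (x ∷ y ∷ r) ≡ (x ∸ y + 1) * bProduct 1 (y ∷ r)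
bProduct1-∷∷ x y r = trans (cong (λ z → product (map h z)) (range1-suc (suc (length r))))
  (cong ((x ∸ y + 1) *_) (cong product (trans (sym (LP.map-∘ {g = h} {f = suc} (range 1 (suc (length r)))))
      (map-cong-local (go (range 1 (suc (length r))) (range1-bounded (suc (length r))))))))
  where
  h : ℕ → ℕ
  h i = bEntry (x ∷ y ∷ r) i + 1
  go : ∀ xs → All (λ i → 1 ≤ i × i ≤ suc (length r)) xs → All (λ i → h (suc i) ≡ bEntry (y ∷ r) i + 1) xs
  go [] [] = []
  go (i ∷ xs) ((p , _) ∷ ps) = cong (_+ 1) (bEntry-∷ x (y ∷ r) i p (s≤s z≤n)) ∷ go xs ps

bProduct1-[-] : ∀ x → bProduct 1 (x ∷ []) ≡ x + 1
bProduct1-[-] x = *-identityʳ (x + 1)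

bProduct1-replicate : ∀ v n X → bProduct 1 (v ∷ (replicate n v ++ X)) ≡ bProduct 1 (v ∷ X)
bProduct1-replicate v zero X = refl
bProduct1-replicate v (suc n) X = trans (bProduct1-∷∷ v v (replicate n v ++ X))
    (trans (cong (_* bProduct 1 (v ∷ (replicate n v ++ X))) (cong (_+ 1) (n∸n≡0 v)))
    (trans (+-identityʳ _) (bProduct1-replicate v n X)))

bProduct1-downBlocks : ∀ w s → (∀ i → 1 ≤ i → i < suc w → 1 ≤ s i) → bProduct 1 (suc w ∷ downBlocks w s) ≡ 2 ^ suc w
bProduct1-downBlocks zero s _ = bProduct1-[-] 1
bProduct1-downBlocks (suc w) s h with s (suc w) | h (suc w) (s≤s z≤n) ≤-refl
... | suc t | _ = trans (bProduct1-∷∷ (suc (suc w)) (suc w) (replicate t (suc w) ++ downBlocks w s))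
                    (trans (cong (λ z → (suc (suc w) ∸ suc w + 1) * z)
                        (trans (bProduct1-replicate (suc w) t (downBlocks w s))
                        (bProduct1-downBlocks w s (λ i p q → h i p (≤-trans q (n≤1+n _))))))
                      (cong (_* (2 ^ suc w)) (cong (_+ 1) (m+n∸n≡m 1 w))))

at-++-offset : ∀ P ys x → at (P ++ ys) (length P + suc x) ≡ at ys (suc x)
at-++-offset P ys x = trans (cong (at (P ++ ys)) (+-suc (length P) x)) (at-++ʳ P ys x)

bEntry-++-offset : ∀ P ys x → 1 ≤ length ys → bEntry (P ++ ys) (length P + suc x) ≡ bEntry ys (suc x)
bEntry-++-offset P ys x l rewrite length-++ P {ys} | <ᵇ-+ (length P) (suc x) (length ys) with suc x <ᵇ length ys
... | true = cong₂ _∸_ (at-++-offset P ys x)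
    (trans (cong (at (P ++ ys)) (sym (+-suc (length P) (suc x)))) (at-++-offset P ys (suc x)))
... | false with length ys | l
...   | suc m | _ = at-++-offset P ys m

bProduct-++ : ∀ P ys → 1 ≤ length ys → bProduct (suc (length P)) (P ++ ys) ≡ bProduct 1 ys
bProduct-++ P ys l = cong product (trans
    (cong (λ z → map h (map (suc (length P) +_) (upTo (z ∸ length P)))) (length-++ P {ys}))
   (trans (cong (λ z → map h (map (suc (length P) +_) (upTo z))) (m+n∸m≡n (length P) (length ys)))
    (trans (sym (LP.map-∘ (upTo (length ys))))
     (trans (map-cong-local (go (upTo (length ys))))
      (LP.map-∘ (upTo (length ys)))))))
  where
  h : ℕ → ℕ
  h i = bEntry (P ++ ys) i + 1
  go : ∀ xs → All (λ x → h (suc (length P) + x) ≡ bEntry ys (suc x) + 1) xs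
  go [] = []
  go (x ∷ xs) = cong (_+ 1) (trans (cong (bEntry (P ++ ys)) (sym (+-suc (length P) x))) (bEntry-++-offset P ys x l)) ∷ go xs

bProduct-dSeq : ∀ w s → (∀ i → 1 ≤ i → i < suc w → 1 ≤ s i) → bProduct (suc w) (dSeq (suc w) s) ≡ 2 ^ suc w
bProduct-dSeq w s h = begin
  bProduct (suc w) (dSeq (suc w) s)                         ≡⟨ cong (bProduct (suc w)) dSeq-split ⟩
  bProduct (suc w) (stair w ++ descent)                        ≡⟨ cong (λ z → bProduct (suc z) (stair w ++ descent))
      (sym (length-stair w)) ⟩
  bProduct (suc (length (stair w))) (stair w ++ descent)       ≡⟨ bProduct-++ (stair w) descent (s≤s z≤n) ⟩
  bProduct 1 (suc w ∷ replicate (s (suc w)) (suc w) ++ downBlocks w s)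
                                                            ≡⟨ bProduct1-replicate (suc w) (s (suc w)) (downBlocks w s) ⟩
  bProduct 1 (suc w ∷ downBlocks w s)                       ≡⟨ bProduct1-downBlocks w s h ⟩
  2 ^ suc w                                                 ∎
  where
  open ≡-Reasoning
  descent : List ℕ
  descent = suc w ∷ downBlocks (suc w) s
  dSeq-split : dSeq (suc w) s ≡ stair w ++ descent
  dSeq-split = trans (cong (_++ downBlocks (suc w) s) (stair-∷ʳ w)) (++-assoc (stair w) (suc w ∷ []) (downBlocks (suc w) s))

dSeq-parts-unique : ∀ q s → (∀ i → 1 ≤ i → i < q → 2 ≤ s i) → HasSize (InClassParts (dSeq q s) q) 1
dSeq-parts-unique q s h = HasSize-cong parts⇔ (count-dSeq-parts q s h)
  where
  class⇔ : ∀ α → HasDiag (at (dSeq q s)) α ⇔ InClass (dSeq q s) α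
  class⇔ = HasDiag⇔InClass (dSeq q s) (dSeq-positive q s)
  parts⇔ : ∀ α → (HasDiag (at (dSeq q s)) α × length α ≡ q) ⇔ InClassParts (dSeq q s) q α
  parts⇔ α = mk⇔ (λ (c , l) → to⇔ (class⇔ α) c , l) (λ (c , l) → from⇔ (class⇔ α) c , l)

count-dSeq-bProduct : ∀ q s → 0 < q → (∀ i → 1 ≤ i → i < q → 2 ≤ s i) → 1 ≤ s q →
  HasSize (InClass (dSeq q s)) (bProduct q (dSeq q s))
count-dSeq-bProduct (suc w) s _ h1 h2 = subst (HasSize (InClass (dSeq (suc w) s)))
    (sym (bProduct-dSeq w s (λ i p q → ≤-trans (s≤s z≤n) (h1 i p q))))
  (HasSize-cong (HasDiag⇔InClass (dSeq (suc w) s) (dSeq-positive (suc w) s)) (count-dSeq (suc w) s h1 (λ _ → h2)))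

-- Lengthening a plateau

Plateau : ℕ → List ℕ → Set
Plateau K α = diag α K ≡ diag α (suc K) × diag α K < K

-- insertDiag lengthens the leading rows that reach past the plateau; at the first row that
-- does not, it duplicates the next row when the rows below fill every earlier diagonal.
mutual
  insertDiag : ℕ → List ℕ → List ℕ
  insertDiag zero α = α
  insertDiag (suc k) [] = []
  insertDiag (suc k) (a ∷ β) = insertDiagCase k a β (suc (suc k) ≤? a) (diag β k ≟ k)

  insertDiagCase : (k a : ℕ) (β : List ℕ) → Dec (suc (suc k) ≤ a) → Dec (diag β k ≡ k) → List ℕ
  insertDiagCase k a β (yes _) _ = suc a ∷ insertDiag k β
  insertDiagCase k a β (no _) (yes _) = a ∷ hd β ∷ β
  insertDiagCase k a β (no _) (no _) = a ∷ insertDiag k β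

Plateau-top : ∀ k a β → suc (suc k) ≤ a → Plateau (suc k) (a ∷ β) → Plateau k β
Plateau-top k a β p (e , lt) = e' , lt'
  where
  g1 = reaches-≤ a (suc k) (≤-trans (n≤1+n _) p)
  g2 = reaches-≤ a (suc (suc k)) p
  e' : diag β k ≡ diag β (suc k)
  e' = suc-injective (trans (cong (_+ diag β k) (sym g1)) (trans e (cong (_+ diag β (suc k)) g2)))
  lt' : diag β k < k
  lt' = ≤-pred (subst (_< suc k) (cong (_+ diag β k) g1) lt)

Plateau-nontop : ∀ k a β → IsPartition (a ∷ β) → ¬ (suc (suc k) ≤ a) → Plateau (suc k) (a ∷ β) →
  a ≤ k × diag β k ≡ diag β (suc k) × diag β k ≡ diag (a ∷ β) (suc k)
Plateau-nontop k a β ip np (e , lt) with suc k ≤? a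
... | yes q = ⊥-elim (<-irrefl refl (subst (λ z → suc z < suc k) full (subst (_< suc k) (cong (_+ diag β k) g1) lt)))
  where
  g1 = reaches-≤ a (suc k) q
  g2 = reaches-< a (suc (suc k)) (≰⇒> np)
  e'' : suc (diag β k) ≡ diag β (suc k)
  e'' = trans (cong (_+ diag β k) (sym g1)) (trans e (cong (_+ diag β (suc k)) g2))
  full : diag β k ≡ k
  full = diag-increase⇒full β k (IsPartition-tail a β ip) (subst (diag β k <_) e'' ≤-refl)
... | no nq = ≤-pred (≰⇒> nq) , trans (cong (_+ diag β k) (sym g1)) (trans e (cong (_+ diag β (suc k)) g2)) , cong
    (_+ diag β k) (sym g1)
  where
  g1 = reaches-< a (suc k) (≰⇒> nq)
  g2 = reaches-< a (suc (suc k)) (≤-trans (≰⇒> nq) (n≤1+n _))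

InsertsDiagonal : ℕ → List ℕ → Set
InsertsDiagonal K α = (∀ j → j ≤ suc K → diag (insertDiag K α) j ≡ diag α j) ×
    (∀ j → suc K ≤ j → diag (insertDiag K α) (suc j) ≡ diag α j)

FullShape : ℕ → ℕ → List ℕ → Set
FullShape k a β = Σ ℕ λ k' → Σ (List ℕ) λ β' → (k ≡ suc k') × (a ≡ k) × (β ≡ k ∷ β')

fullShape : ∀ k a β → IsPartition (a ∷ β) → a ≤ k → diag β k ≡ k → FullShape k a β
fullShape zero a β ((pa ∷ _) , _) le f = ⊥-elim (<-irrefl refl (≤-trans pa le))
fullShape (suc k') a β ip le f with β | diag-full⇒≤hd β k' f | IsPartition-head a β ip
... | [] | () | _
... | b ∷ β' | h1 | h2 = k' , β' , refl , ≤-antisym le (≤-trans h1 h2) , cong (_∷ β') (≤-antisym (≤-trans h2 le) h1)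

DiagonalInserted : ℕ → List ℕ → List ℕ → Set
DiagonalInserted K α γ = (∀ j → j ≤ suc K → diag γ j ≡ diag α j) × (∀ j → suc K ≤ j → diag γ (suc j) ≡ diag α j)

insert-top : ∀ k a β → suc (suc k) ≤ a → InsertsDiagonal k β → DiagonalInserted (suc k) (a ∷ β) (suc a ∷ insertDiag k β)
insert-top k a β p ih = lo , hi
  where
  lo : ∀ j → j ≤ suc (suc k) → diag (suc a ∷ insertDiag k β) j ≡ diag (a ∷ β) j
  lo zero _ = refl
  lo (suc j) le = cong₂ _+_ (trans (reaches-≤ a j (≤-trans (n≤1+n j) (≤-trans le p)))
      (sym (reaches-≤ a (suc j) (≤-trans le p)))) (proj₁ ih j (≤-pred le))
  hi : ∀ j → suc (suc k) ≤ j → diag (suc a ∷ insertDiag k β) (suc j) ≡ diag (a ∷ β) j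
  hi (suc j) le = cong (reaches a (suc j) +_) (proj₂ ih j (≤-pred le))

insert-rec : ∀ k a β → a ≤ k → InsertsDiagonal k β → DiagonalInserted (suc k) (a ∷ β) (a ∷ insertDiag k β)
insert-rec k a β a≤k ih = lo , hi
  where
  lo : ∀ j → j ≤ suc (suc k) → diag (a ∷ insertDiag k β) j ≡ diag (a ∷ β) j
  lo zero _ = refl
  lo (suc j) le = cong (reaches a (suc j) +_) (proj₁ ih j (≤-pred le))
  hi : ∀ j → suc (suc k) ≤ j → diag (a ∷ insertDiag k β) (suc j) ≡ diag (a ∷ β) j
  hi (suc j) le = trans (cong₂ _+_ (reaches-< a (suc (suc j)) (s≤s (≤-trans aj (n≤1+n j)))) (proj₂ ih j (≤-pred le)))
                        (sym (cong (_+ diag β j) (reaches-< a (suc j) (s≤s aj))))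
    where
    aj : a ≤ j
    aj = ≤-trans a≤k (≤-trans (n≤1+n k) (≤-pred le))

insert-full : ∀ k' β' → IsPartition (suc k' ∷ β') → diag (suc k' ∷ β') (suc k') ≡ suc k' →
  diag (suc k' ∷ β') (suc k') ≡ diag (suc k' ∷ β') (suc (suc k')) →
  DiagonalInserted (suc (suc k')) (suc k' ∷ suc k' ∷ β') (suc k' ∷ suc k' ∷ suc k' ∷ β')
insert-full k' β' ipβ f e1 = lo , hi
  where
  X : ∀ i → i ≤ suc (suc k') → diag (suc k' ∷ suc k' ∷ β') i ≡ diag (suc k' ∷ β') i
  X zero _ = refl
  X (suc i) le with m≤n⇒m<n∨m≡n (≤-pred le)
  ... | inj₁ lt = trans (cong₂ _+_ (reaches-≤ (suc k') (suc i) lt)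
      (diag-full-below (suc k' ∷ β') (suc k') ipβ f i (≤-trans (n≤1+n i) lt)))
      (sym (diag-full-below (suc k' ∷ β') (suc k') ipβ f (suc i) lt))
  ... | inj₂ refl = trans (cong₂ _+_ (reaches-< (suc k') (suc (suc k')) ≤-refl) f) (trans (sym f) e1)
  lo : ∀ j → j ≤ suc (suc (suc k')) → diag (suc k' ∷ suc k' ∷ suc k' ∷ β') j ≡ diag (suc k' ∷ suc k' ∷ β') j
  lo zero _ = refl
  lo (suc j) le = cong (reaches (suc k') (suc j) +_) (X j (≤-pred le))
  hi : ∀ j → suc (suc (suc k')) ≤ j → diag (suc k' ∷ suc k' ∷ suc k' ∷ β') (suc j) ≡ diag (suc k' ∷ suc k' ∷ β') j
  hi (suc j) le = trans (cong₂ _+_ (reaches-< (suc k') (suc (suc j)) (≤-trans l1 (n≤1+n _)))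
      (cong₂ _+_ (reaches-< (suc k') (suc j) l1) refl))
                        (sym (cong (_+ diag (suc k' ∷ β') j) (reaches-< (suc k') (suc j) l1)))
    where
    l1 : suc k' < suc j
    l1 = ≤-trans (≤-pred le) (n≤1+n j)

insertDiag-diag : ∀ K α → IsPartition α → Plateau K α → InsertsDiagonal K α
insertDiag-diag zero [] _ (_ , ())
insertDiag-diag zero (a ∷ β) _ (_ , ())
insertDiag-diag (suc k) [] ip pl = (λ j _ → refl) , (λ j _ → refl)
insertDiag-diag (suc k) (a ∷ β) ip pl with suc (suc k) ≤? a | diag β k ≟ k
... | yes p | _ = insert-top k a β p (insertDiag-diag k β (IsPartition-tail a β ip) (Plateau-top k a β p pl))
... | no np | no nf = insert-rec k a β (proj₁ nt)
    (insertDiag-diag k β (IsPartition-tail a β ip) (proj₁ (proj₂ nt) , ≤∧≢⇒< (diag-≤ β k) nf))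
  where nt = Plateau-nontop k a β ip np pl
... | no np | yes f = go (fullShape k a β ip (proj₁ nt) f)
  where
  nt = Plateau-nontop k a β ip np pl
  go : FullShape k a β → DiagonalInserted (suc k) (a ∷ β) (a ∷ hd β ∷ β)
  go (k' , β' , refl , refl , refl) = insert-full k' β' (IsPartition-tail _ _ ip) f (proj₁ (proj₂ nt))

insertDiag-head-≤ : ∀ k β → hd (insertDiag k β) ≤ suc (hd β)
insertDiag-head-≤ zero β = n≤1+n _
insertDiag-head-≤ (suc k) [] = z≤n
insertDiag-head-≤ (suc k) (b ∷ β) with suc (suc k) ≤? b | diag β k ≟ k
... | yes _ | _ = ≤-refl
... | no _ | yes _ = n≤1+n b
... | no _ | no _ = n≤1+n b

insertDiag-head-small : ∀ k β → hd β ≤ k → hd (insertDiag k β) ≤ hd β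
insertDiag-head-small zero β _ = ≤-refl
insertDiag-head-small (suc k) [] _ = z≤n
insertDiag-head-small (suc k) (b ∷ β) le with suc (suc k) ≤? b | diag β k ≟ k
... | yes p | _ = ⊥-elim (<-irrefl refl (≤-trans p le))
... | no _ | yes _ = ≤-refl
... | no _ | no _ = ≤-refl

insertDiag-IsPartition : ∀ K α → IsPartition α → Plateau K α → IsPartition (insertDiag K α)
insertDiag-IsPartition zero α ip _ = ip
insertDiag-IsPartition (suc k) [] ip _ = ip
insertDiag-IsPartition (suc k) (a ∷ β) ip pl with suc (suc k) ≤? a | diag β k ≟ k
... | yes p | _ = IsPartition-∷ (suc a) (insertDiag k β) (s≤s z≤n)
    (≤-trans (insertDiag-head-≤ k β) (s≤s (IsPartition-head a β ip)))
    (insertDiag-IsPartition k β (IsPartition-tail a β ip) (Plateau-top k a β p pl))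
... | no np | no nf = IsPartition-∷ a (insertDiag k β) (All.head (proj₁ ip))
    (≤-trans (insertDiag-head-small k β (≤-trans (IsPartition-head a β ip) (proj₁ nt))) (IsPartition-head a β ip))
                        (insertDiag-IsPartition k β (IsPartition-tail a β ip) (proj₁ (proj₂ nt) , ≤∧≢⇒< (diag-≤ β k) nf))
  where
  nt = Plateau-nontop k a β ip np pl
... | no np | yes f = go (fullShape k a β ip (proj₁ nt) f)
  where
  nt = Plateau-nontop k a β ip np pl
  go : FullShape k a β → IsPartition (a ∷ hd β ∷ β)
  go (k' , β' , refl , refl , refl) = IsPartition-∷ (suc k') (suc k' ∷ suc k' ∷ β') (s≤s z≤n) ≤-refl
      (IsPartition-∷ (suc k') (suc k' ∷ β') (s≤s z≤n) ≤-refl (IsPartition-tail _ _ ip))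

DoublePlateau : ℕ → List ℕ → Set
DoublePlateau K γ = diag γ K ≡ diag γ (suc K) × diag γ (suc K) ≡ diag γ (suc (suc K)) × diag γ K < K

mutual
  removeDiag : ℕ → List ℕ → List ℕ
  removeDiag zero γ = γ
  removeDiag (suc k) [] = []
  removeDiag (suc k) (c ∷ δ) = removeDiagCase k c δ (suc (suc (suc k)) ≤? c) (diag δ k ≟ k)

  removeDiagCase : (k c : ℕ) (δ : List ℕ) → Dec (suc (suc (suc k)) ≤ c) → Dec (diag δ k ≡ k) → List ℕ
  removeDiagCase k c δ (yes _) _ = pred c ∷ removeDiag k δ
  removeDiagCase k c δ (no _) (yes _) = c ∷ tl δ
  removeDiagCase k c δ (no _) (no _) = c ∷ removeDiag k δ

DoublePlateau-top : ∀ k c δ → suc (suc (suc k)) ≤ c → DoublePlateau (suc k) (c ∷ δ) → DoublePlateau k δ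
DoublePlateau-top k c δ p (e1 , e2 , lt) = e1' , e2' , lt'
  where
  g1 = reaches-≤ c (suc k) (≤-trans (n≤1+n _) (≤-trans (n≤1+n _) p))
  g2 = reaches-≤ c (suc (suc k)) (≤-trans (n≤1+n _) p)
  g3 = reaches-≤ c (suc (suc (suc k))) p
  e1' : diag δ k ≡ diag δ (suc k)
  e1' = suc-injective (trans (cong (_+ diag δ k) (sym g1)) (trans e1 (cong (_+ diag δ (suc k)) g2)))
  e2' : diag δ (suc k) ≡ diag δ (suc (suc k))
  e2' = suc-injective (trans (cong (_+ diag δ (suc k)) (sym g2)) (trans e2 (cong (_+ diag δ (suc (suc k))) g3)))
  lt' : diag δ k < k
  lt' = ≤-pred (subst (_< suc k) (cong (_+ diag δ k) g1) lt)

DoublePlateau-nontop : ∀ k c δ → IsPartition (c ∷ δ) → ¬ (suc (suc (suc k)) ≤ c) → DoublePlateau (suc k) (c ∷ δ) →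
  c ≤ k × diag δ k ≡ diag δ (suc k) × diag δ (suc k) ≡ diag δ (suc (suc k)) × diag δ k ≡ diag (c ∷ δ) (suc k)
DoublePlateau-nontop k c δ ip np (e1 , e2 , lt) with suc (suc k) ≤? c
... | yes q = ⊥-elim (<⇒≱ (subst (_< suc k) e1 lt) (≤-trans (n≤1+n (suc k)) (≤-reflexive (sym fullγ))))
  where
  g2 = reaches-≤ c (suc (suc k)) q
  g3 = reaches-< c (suc (suc (suc k))) (≰⇒> np)
  inc : suc (diag δ (suc k)) ≡ diag δ (suc (suc k))
  inc = trans (cong (_+ diag δ (suc k)) (sym g2)) (trans e2 (cong (_+ diag δ (suc (suc k))) g3))
  full : diag δ (suc k) ≡ suc k
  full = diag-increase⇒full δ (suc k) (IsPartition-tail c δ ip) (subst (diag δ (suc k) <_) inc ≤-refl)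
  fullγ : diag (c ∷ δ) (suc (suc k)) ≡ suc (suc k)
  fullγ = trans (cong₂ _+_ g2 full) refl
... | no nq with suc k ≤? c
...   | yes r = ⊥-elim (<-irrefl refl (subst (_< suc k) (trans (cong (_+ diag δ k) g1) (cong suc full)) lt))
  where
  g1 = reaches-≤ c (suc k) r
  g2 = reaches-< c (suc (suc k)) (≰⇒> nq)
  inc : suc (diag δ k) ≡ diag δ (suc k)
  inc = trans (cong (_+ diag δ k) (sym g1)) (trans e1 (cong (_+ diag δ (suc k)) g2))
  full : diag δ k ≡ k
  full = diag-increase⇒full δ k (IsPartition-tail c δ ip) (subst (diag δ k <_) inc ≤-refl)
...   | no nr = ≤-pred (≰⇒> nr) ,
                trans (cong (_+ diag δ k) (sym g1)) (trans e1 (cong (_+ diag δ (suc k)) g2)) ,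
                trans (cong (_+ diag δ (suc k)) (sym g2)) (trans e2 (cong (_+ diag δ (suc (suc k))) g3)) ,
                cong (_+ diag δ k) (sym g1)
  where
  g1 = reaches-< c (suc k) (≰⇒> nr)
  g2 = reaches-< c (suc (suc k)) (≤-trans (≰⇒> nr) (n≤1+n _))
  g3 = reaches-< c (suc (suc (suc k))) (≤-trans (≰⇒> nr) (≤-trans (n≤1+n _) (n≤1+n _)))

DiagonalRemoved : ℕ → List ℕ → List ℕ → Set
DiagonalRemoved K γ ρ = (∀ j → j ≤ suc K → diag ρ j ≡ diag γ j) × (∀ j → suc K ≤ j → diag ρ j ≡ diag γ (suc j))

RemovesDiagonal : ℕ → List ℕ → Set
RemovesDiagonal K γ = DiagonalRemoved K γ (removeDiag K γ)

remove-top : ∀ k c δ → suc (suc (suc k)) ≤ c → RemovesDiagonal k δ →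
  DiagonalRemoved (suc k) (c ∷ δ) (pred c ∷ removeDiag k δ)
remove-top k (suc c') δ p ih = lo , hi
  where
  lo : ∀ j → j ≤ suc (suc k) → diag (c' ∷ removeDiag k δ) j ≡ diag (suc c' ∷ δ) j
  lo zero _ = refl
  lo (suc j) le = cong₂ _+_ (trans (reaches-≤ c' (suc j) (≤-trans le (≤-pred p)))
      (sym (reaches-≤ c' j (≤-trans (n≤1+n j) (≤-trans le (≤-pred p)))))) (proj₁ ih j (≤-pred le))
  hi : ∀ j → suc (suc k) ≤ j → diag (c' ∷ removeDiag k δ) j ≡ diag (suc c' ∷ δ) (suc j)
  hi (suc j) le = cong (reaches c' (suc j) +_) (proj₂ ih j (≤-pred le))

remove-rec : ∀ k c δ → c ≤ k → RemovesDiagonal k δ → DiagonalRemoved (suc k) (c ∷ δ) (c ∷ removeDiag k δ)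
remove-rec k c δ c≤k ih = lo , hi
  where
  lo : ∀ j → j ≤ suc (suc k) → diag (c ∷ removeDiag k δ) j ≡ diag (c ∷ δ) j
  lo zero _ = refl
  lo (suc j) le = cong (reaches c (suc j) +_) (proj₁ ih j (≤-pred le))
  hi : ∀ j → suc (suc k) ≤ j → diag (c ∷ removeDiag k δ) j ≡ diag (c ∷ δ) (suc j)
  hi (suc j) le = trans (cong₂ _+_ (reaches-< c (suc j) (s≤s cj)) (proj₂ ih j (≤-pred le)))
                        (sym (cong (_+ diag δ (suc j)) (reaches-< c (suc (suc j)) (s≤s (≤-trans cj (n≤1+n j))))))
    where
    cj : c ≤ j
    cj = ≤-trans c≤k (≤-trans (n≤1+n k) (≤-pred le))

remove-full : ∀ k' δ' → IsPartition (suc k' ∷ δ') → diag (suc k' ∷ δ') (suc k') ≡ suc k' →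
  diag (suc k' ∷ δ') (suc k') ≡ diag (suc k' ∷ δ') (suc (suc k')) → diag (suc k' ∷ δ') (suc (suc k')) ≡ diag
      (suc k' ∷ δ') (suc (suc (suc k'))) →
  DiagonalRemoved (suc (suc k')) (suc k' ∷ suc k' ∷ δ') (suc k' ∷ δ')
remove-full k' δ' ipδ f e1 e2 = lo , hi
  where
  δδ = suc k' ∷ δ'
  ipδ' = IsPartition-tail _ δ' ipδ
  l0 : diag δ' (suc k') ≡ suc k'
  l0 = trans (cong (_+ diag δ' (suc k')) (sym (reaches-< (suc k') (suc (suc k')) ≤-refl))) (trans (sym e1) f)
  X : ∀ i → i ≤ suc (suc k') → diag δ' i ≡ diag δδ i
  X i le with m≤n⇒m<n∨m≡n le
  ... | inj₁ lt = trans (diag-full-below δ' (suc k') ipδ' l0 i (≤-pred lt))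
      (sym (diag-full-below δδ (suc k') ipδ f i (≤-pred lt)))
  ... | inj₂ refl = trans (sym (cong (_+ diag δ' (suc (suc k')))
      (reaches-< (suc k') (suc (suc (suc k'))) (n≤1+n (suc (suc k')))))) (sym e2)
  lo : ∀ j → j ≤ suc (suc (suc k')) → diag (suc k' ∷ δ') j ≡ diag (suc k' ∷ suc k' ∷ δ') j
  lo zero _ = refl
  lo (suc j) le = cong (reaches (suc k') (suc j) +_) (X j (≤-pred le))
  hi : ∀ j → suc (suc (suc k')) ≤ j → diag (suc k' ∷ δ') j ≡ diag (suc k' ∷ suc k' ∷ δ') (suc j)
  hi j le = sym (cong (_+ diag (suc k' ∷ δ') j)
      (reaches-< (suc k') (suc j) (≤-trans (n≤1+n (suc (suc k'))) (≤-trans le (n≤1+n j)))))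

removeDiag-diag : ∀ K γ → IsPartition γ → DoublePlateau K γ → RemovesDiagonal K γ
removeDiag-diag zero [] _ (_ , _ , ())
removeDiag-diag zero (c ∷ δ) _ (_ , _ , ())
removeDiag-diag (suc k) [] ip pl = (λ j _ → refl) , (λ j _ → refl)
removeDiag-diag (suc k) (c ∷ δ) ip pl with suc (suc (suc k)) ≤? c | diag δ k ≟ k
... | yes p | _ = remove-top k c δ p (removeDiag-diag k δ (IsPartition-tail c δ ip) (DoublePlateau-top k c δ p pl))
... | no np | no nf = remove-rec k c δ (proj₁ nt)
    (removeDiag-diag k δ (IsPartition-tail c δ ip) (proj₁ (proj₂ nt) , proj₁ (proj₂ (proj₂ nt)) , ≤∧≢⇒< (diag-≤ δ k) nf))
  where nt = DoublePlateau-nontop k c δ ip np pl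
... | no np | yes f = go (fullShape k c δ ip (proj₁ nt) f)
  where
  nt = DoublePlateau-nontop k c δ ip np pl
  go : FullShape k c δ → DiagonalRemoved (suc k) (c ∷ δ) (c ∷ tl δ)
  go (k' , δ' , refl , refl , refl) = remove-full k' δ' (IsPartition-tail _ _ ip) f (proj₁ (proj₂ nt))
      (proj₁ (proj₂ (proj₂ nt)))

removeDiag-head-≤ : ∀ k δ → hd (removeDiag k δ) ≤ hd δ
removeDiag-head-≤ zero δ = ≤-refl
removeDiag-head-≤ (suc k) [] = z≤n
removeDiag-head-≤ (suc k) (d ∷ δ) with suc (suc (suc k)) ≤? d | diag δ k ≟ k
... | yes _ | _ = pred[n]≤n
... | no _ | yes _ = ≤-refl
... | no _ | no _ = ≤-refl

removeDiag-head-top : ∀ k δ → suc (suc k) ≤ hd δ → 1 ≤ k → hd (removeDiag k δ) ≡ pred (hd δ)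
removeDiag-head-top (suc k) (d ∷ δ) p _ with suc (suc (suc k)) ≤? d | diag δ k ≟ k
... | yes _ | _ = refl
... | no np | _ = ⊥-elim (np p)

removeDiag-IsPartition : ∀ K γ → IsPartition γ → DoublePlateau K γ → IsPartition (removeDiag K γ)
removeDiag-IsPartition zero γ ip _ = ip
removeDiag-IsPartition (suc k) [] ip _ = ip
removeDiag-IsPartition (suc k) (c ∷ δ) ip pl with suc (suc (suc k)) ≤? c | diag δ k ≟ k
... | yes p | _ = IsPartition-∷ (pred c) (removeDiag k δ) (≤-trans (s≤s z≤n) (pred-mono-≤ p)) hdle
    (removeDiag-IsPartition k δ (IsPartition-tail c δ ip) pδ)
  where
  pδ = DoublePlateau-top k c δ p pl
  k1 : 1 ≤ k
  k1 = ≤-trans (s≤s z≤n) (proj₂ (proj₂ pδ))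
  hdle : hd (removeDiag k δ) ≤ pred c
  hdle with hd δ <? c
  ... | yes lt = ≤-trans (removeDiag-head-≤ k δ) (pred-mono-≤ lt)
  ... | no nlt = ≤-reflexive (trans (removeDiag-head-top k δ
      (≤-trans (n≤1+n _) (subst (suc (suc (suc k)) ≤_) (sym hδ) p)) k1) (cong pred hδ))
    where
    hδ : hd δ ≡ c
    hδ = ≤-antisym (IsPartition-head c δ ip) (≮⇒≥ nlt)
... | no np | no nf = IsPartition-∷ c (removeDiag k δ) (All.head (proj₁ ip))
    (≤-trans (removeDiag-head-≤ k δ) (IsPartition-head c δ ip))
                        (removeDiag-IsPartition k δ (IsPartition-tail c δ ip)
                            (proj₁ (proj₂ nt) , proj₁ (proj₂ (proj₂ nt)) , ≤∧≢⇒< (diag-≤ δ k) nf))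
  where
  nt = DoublePlateau-nontop k c δ ip np pl
... | no np | yes f = go (fullShape k c δ ip (proj₁ nt) f)
  where
  nt = DoublePlateau-nontop k c δ ip np pl
  go : FullShape k c δ → IsPartition (c ∷ tl δ)
  go (k' , δ' , refl , refl , refl) = IsPartition-∷ (suc k') δ' (s≤s z≤n)
      (IsPartition-head _ δ' (IsPartition-tail _ _ ip)) (IsPartition-tail _ δ' (IsPartition-tail _ _ ip))

removeDiag-insertDiag-top : ∀ k a β → suc (suc k) ≤ a → removeDiag k (insertDiag k β) ≡ β →
  removeDiag (suc k) (suc a ∷ insertDiag k β) ≡ a ∷ β
removeDiag-insertDiag-top k a β p ih with suc (suc (suc k)) ≤? suc a | diag (insertDiag k β) k ≟ k
... | yes _ | _ = cong (a ∷_) ih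
... | no n | _ = ⊥-elim (n (s≤s p))

removeDiag-insertDiag-full : ∀ k' β' → IsPartition (suc k' ∷ β') → diag (suc k' ∷ β') (suc k') ≡ suc k' →
  removeDiag (suc (suc k')) (suc k' ∷ suc k' ∷ suc k' ∷ β') ≡ suc k' ∷ suc k' ∷ β'
removeDiag-insertDiag-full k' β' ip f with suc (suc (suc (suc k'))) ≤? suc k' | diag (suc k' ∷ suc k' ∷ β') (suc k') ≟ suc k'
... | yes p | _ = ⊥-elim (<-irrefl refl (≤-trans (s≤s (≤-trans (n≤1+n _) (n≤1+n _))) p))
... | no _ | yes _ = refl
... | no _ | no nf = ⊥-elim (nf (trans (cong (reaches (suc k') (suc k') +_)
    (diag-full-below (suc k' ∷ β') (suc k') ip f k' (n≤1+n k'))) (cong (_+ k') (reaches-≤ (suc k') (suc k') ≤-refl))))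

removeDiag-insertDiag-rec : ∀ k a β → a ≤ k → ¬ (diag (insertDiag k β) k ≡ k) →
  removeDiag k (insertDiag k β) ≡ β → removeDiag (suc k) (a ∷ insertDiag k β) ≡ a ∷ β
removeDiag-insertDiag-rec k a β a≤k nf ih with suc (suc (suc k)) ≤? a | diag (insertDiag k β) k ≟ k
... | yes p | _ = ⊥-elim (<-irrefl refl (≤-trans (s≤s (≤-trans (n≤1+n _) (n≤1+n _))) (≤-trans p a≤k)))
... | no _ | yes f = ⊥-elim (nf f)
... | no _ | no _ = cong (a ∷_) ih

removeDiag-insertDiag : ∀ K α → IsPartition α → Plateau K α → removeDiag K (insertDiag K α) ≡ α
removeDiag-insertDiag zero α _ _ = refl
removeDiag-insertDiag (suc k) [] _ _ = refl
removeDiag-insertDiag (suc k) (a ∷ β) ip pl with suc (suc k) ≤? a | diag β k ≟ k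
... | yes p | _ = removeDiag-insertDiag-top k a β p
    (removeDiag-insertDiag k β (IsPartition-tail a β ip) (Plateau-top k a β p pl))
... | no np | no nf = removeDiag-insertDiag-rec k a β (proj₁ nt)
    (λ e → nf (trans (sym (proj₁ (insertDiag-diag k β (IsPartition-tail a β ip) plβ) k (n≤1+n k))) e))
                        (removeDiag-insertDiag k β (IsPartition-tail a β ip) plβ)
  where
  nt = Plateau-nontop k a β ip np pl
  plβ = (proj₁ (proj₂ nt) , ≤∧≢⇒< (diag-≤ β k) nf)
... | no np | yes f = go (fullShape k a β ip (proj₁ nt) f)
  where
  nt = Plateau-nontop k a β ip np pl
  go : FullShape k a β → removeDiag (suc k) (a ∷ hd β ∷ β) ≡ a ∷ β
  go (k' , β' , refl , refl , refl) = removeDiag-insertDiag-full k' β' (IsPartition-tail _ _ ip) f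

insertDiag-removeDiag-top : ∀ k c δ → suc (suc (suc k)) ≤ c → insertDiag k (removeDiag k δ) ≡ δ →
  insertDiag (suc k) (pred c ∷ removeDiag k δ) ≡ c ∷ δ
insertDiag-removeDiag-top k (suc c') δ (s≤s p) ih with suc (suc k) ≤? c' | diag (removeDiag k δ) k ≟ k
... | yes _ | _ = cong (suc c' ∷_) ih
... | no n | _ = ⊥-elim (n p)

insertDiag-removeDiag-full : ∀ k' δ' → IsPartition (suc k' ∷ suc k' ∷ δ') → diag δ' (suc k') ≡ suc k' →
  insertDiag (suc (suc k')) (suc k' ∷ δ') ≡ suc k' ∷ suc k' ∷ δ'
insertDiag-removeDiag-full k' δ' ip l0 with suc (suc (suc k')) ≤? suc k' | diag δ' (suc k') ≟ suc k'
... | yes p | _ = ⊥-elim (<-irrefl refl (≤-trans (s≤s (n≤1+n _)) p))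
... | no _ | no nf = ⊥-elim (nf l0)
... | no _ | yes _ = cong (λ z → suc k' ∷ z ∷ δ') hdδ'
  where
  hdδ' : hd δ' ≡ suc k'
  hdδ' = ≤-antisym (IsPartition-head _ δ' (IsPartition-tail _ _ ip)) (diag-full⇒≤hd δ' k' l0)

insertDiag-removeDiag-rec : ∀ k c δ → c ≤ k → ¬ (diag (removeDiag k δ) k ≡ k) →
  insertDiag k (removeDiag k δ) ≡ δ → insertDiag (suc k) (c ∷ removeDiag k δ) ≡ c ∷ δ
insertDiag-removeDiag-rec k c δ c≤k nf ih with suc (suc k) ≤? c | diag (removeDiag k δ) k ≟ k
... | yes p | _ = ⊥-elim (<-irrefl refl (≤-trans (s≤s (n≤1+n _)) (≤-trans p c≤k)))
... | no _ | yes f = ⊥-elim (nf f)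
... | no _ | no _ = cong (c ∷_) ih

insertDiag-removeDiag : ∀ K γ → IsPartition γ → DoublePlateau K γ → insertDiag K (removeDiag K γ) ≡ γ
insertDiag-removeDiag zero γ _ _ = refl
insertDiag-removeDiag (suc k) [] _ _ = refl
insertDiag-removeDiag (suc k) (c ∷ δ) ip pl with suc (suc (suc k)) ≤? c | diag δ k ≟ k
... | yes p | _ = insertDiag-removeDiag-top k c δ p
    (insertDiag-removeDiag k δ (IsPartition-tail c δ ip) (DoublePlateau-top k c δ p pl))
... | no np | no nf = insertDiag-removeDiag-rec k c δ (proj₁ nt)
    (λ e → nf (trans (sym (proj₁ (removeDiag-diag k δ (IsPartition-tail c δ ip) plδ) k (n≤1+n k))) e))
                        (insertDiag-removeDiag k δ (IsPartition-tail c δ ip) plδ)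
  where
  nt = DoublePlateau-nontop k c δ ip np pl
  plδ = (proj₁ (proj₂ nt) , proj₁ (proj₂ (proj₂ nt)) , ≤∧≢⇒< (diag-≤ δ k) nf)
... | no np | yes f = go (fullShape k c δ ip (proj₁ nt) f)
  where
  nt = DoublePlateau-nontop k c δ ip np pl
  go : FullShape k c δ → insertDiag (suc k) (c ∷ tl δ) ≡ c ∷ δ
  go (k' , δ' , refl , refl , refl) = insertDiag-removeDiag-full k' δ' ip
      (trans (cong (_+ diag δ' (suc k')) (sym (reaches-< (suc k') (suc (suc k')) ≤-refl)))
      (trans (sym (proj₁ (proj₂ nt))) f))

duplicateAt : ℕ → (ℕ → ℕ) → ℕ → ℕ
duplicateAt K F j with j ≤? suc K
... | yes _ = F j
... | no _ = F (pred j)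

duplicateAt-≤ : ∀ K F j → j ≤ suc K → duplicateAt K F j ≡ F j
duplicateAt-≤ K F j le with j ≤? suc K
... | yes _ = refl
... | no n = ⊥-elim (n le)

duplicateAt-> : ∀ K F j → suc K < j → duplicateAt K F j ≡ F (pred j)
duplicateAt-> K F j lt with j ≤? suc K
... | yes le = ⊥-elim (<-irrefl refl (≤-trans lt le))
... | no _ = refl

plateau-⟷ : ∀ K F → 1 ≤ K → F K ≡ F (suc K) → F K < K → HasDiag F ⟷ HasDiag (duplicateAt K F)
plateau-⟷ (suc k) F _ e lt = record
  { to = insertDiag K ; from = removeDiag K
  ; to-resp = to-resp ; from-resp = from-resp
  ; from∘to = λ α (ip , h) → removeDiag-insertDiag K α ip (plat {α} h)
  ; to∘from = λ γ (ip , h) → insertDiag-removeDiag K γ ip (plat⁺ {γ} h) }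
  where
  K = suc k
  plat : ∀ {α} → (∀ j → diag α (suc j) ≡ F (suc j)) → Plateau K α
  plat h = trans (h k) (trans e (sym (h K))) , subst (_< K) (sym (h k)) lt
  SF = duplicateAt K F
  plat⁺ : ∀ {γ} → (∀ j → diag γ (suc j) ≡ SF (suc j)) → DoublePlateau K γ
  plat⁺ {γ} h = trans l0 (trans e (sym l1)) , trans l1 (sym l2) , subst (_< K) (sym l0) lt
    where
    l0 : diag γ K ≡ F K
    l0 = trans (h k) (duplicateAt-≤ K F K (n≤1+n K))
    l1 : diag γ (suc K) ≡ F (suc K)
    l1 = trans (h K) (duplicateAt-≤ K F (suc K) ≤-refl)
    l2 : diag γ (suc (suc K)) ≡ F (suc K)
    l2 = trans (h (suc K)) (duplicateAt-> K F (suc (suc K)) ≤-refl)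
  to-resp : ∀ α → HasDiag F α → HasDiag SF (insertDiag K α)
  to-resp α (ip , h) = insertDiag-IsPartition K α ip (plat {α} h) , lv
    where
    pl = insertDiag-diag K α ip (plat {α} h)
    lv : ∀ j → diag (insertDiag K α) (suc j) ≡ SF (suc j)
    lv j with j ≤? K
    ... | yes le = trans (proj₁ pl (suc j) (s≤s le)) (trans (h j) (sym (duplicateAt-≤ K F (suc j) (s≤s le))))
    ... | no nle = trans (proj₂ pl j gt) (trans (lvα j gt) (sym (duplicateAt-> K F (suc j) (s≤s gt))))
      where
      gt : suc K ≤ j
      gt = ≰⇒> nle
      lvα : ∀ j → suc K ≤ j → diag α j ≡ F j
      lvα (suc j') _ = h j'
  from-resp : ∀ γ → HasDiag SF γ → HasDiag F (removeDiag K γ)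
  from-resp γ (ip , h) = removeDiag-IsPartition K γ ip (plat⁺ {γ} h) , lv
    where
    pl = removeDiag-diag K γ ip (plat⁺ {γ} h)
    lv : ∀ j → diag (removeDiag K γ) (suc j) ≡ F (suc j)
    lv j with j ≤? K
    ... | yes le = trans (proj₁ pl (suc j) (s≤s le)) (trans (h j) (duplicateAt-≤ K F (suc j) (s≤s le)))
    ... | no nle = trans (proj₂ pl (suc j) (≤-trans gt (n≤1+n j)))
        (trans (h (suc j)) (duplicateAt-> K F (suc (suc j)) (s≤s (≤-trans gt (n≤1+n j)))))
      where
      gt : suc K ≤ j
      gt = ≰⇒> nle

duplicateAt-list-offset : ∀ P v Y t → duplicateAt (suc (length P)) (at (P ++ v ∷ v ∷ Y)) (suc (length P + t)) ≡ at (P ++ v ∷ v ∷ v ∷ Y) (suc (length P + t))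
duplicateAt-list-offset P v Y zero = trans (duplicateAt-≤ (suc (length P)) (at (P ++ v ∷ v ∷ Y)) (suc (length P + 0))
    (≤-trans (s≤s (≤-reflexive (+-identityʳ _))) (n≤1+n _)))
    (trans (at-++ʳ P (v ∷ v ∷ Y) 0) (sym (at-++ʳ P (v ∷ v ∷ v ∷ Y) 0)))
duplicateAt-list-offset P v Y (suc zero) = trans (duplicateAt-≤ (suc (length P)) (at (P ++ v ∷ v ∷ Y))
    (suc (length P + 1)) (s≤s (≤-reflexive (+-comm (length P) 1))))
    (trans (at-++ʳ P (v ∷ v ∷ Y) 1) (sym (at-++ʳ P (v ∷ v ∷ v ∷ Y) 1)))
duplicateAt-list-offset P v Y (suc (suc t)) =
  trans (duplicateAt-> (suc (length P)) (at (P ++ v ∷ v ∷ Y)) (suc (length P + suc (suc t)))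
      (s≤s (subst (suc (suc (length P)) ≤_) (sym (trans (+-suc (length P) (suc t)) (cong suc (+-suc (length P) t))))
      (s≤s (s≤s (m≤m+n (length P) t))))))
   (trans (trans (cong (at (P ++ v ∷ v ∷ Y)) (+-suc (length P) (suc t))) (at-++ʳ P (v ∷ v ∷ Y) (suc t)))
     (trans (sym (at-∷ v (v ∷ v ∷ Y) (suc t))) (sym (at-++ʳ P (v ∷ v ∷ v ∷ Y) (suc (suc t))))))

duplicateAt-list : ∀ P v Y j → duplicateAt (suc (length P)) (at (P ++ v ∷ v ∷ Y)) (suc j) ≡ at (P ++ v ∷ v ∷ v ∷ Y) (suc j)
duplicateAt-list P v Y j with j <? length P
... | yes lt = trans (duplicateAt-≤ (suc (length P)) (at (P ++ v ∷ v ∷ Y)) (suc j)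
    (≤-trans (s≤s (≤-trans (n≤1+n _) lt)) (n≤1+n _))) (trans (at-++ˡ P _ j lt) (sym (at-++ˡ P _ j lt)))
... | no nlt = subst (λ z → duplicateAt (suc (length P)) (at (P ++ v ∷ v ∷ Y)) (suc z) ≡ at (P ++ v ∷ v ∷ v ∷ Y)
    (suc z)) (m+[n∸m]≡n (≮⇒≥ nlt)) (duplicateAt-list-offset P v Y (j ∸ length P))

min2 : ℕ → ℕ
min2 n = if n ≤ᵇ 2 then n else 2

min2-≥2 : ∀ n → min2 (suc (suc n)) ≡ 2
min2-≥2 zero = refl
min2-≥2 (suc n) = refl

triple-⟷ : ∀ P v Y → v ≤ length P → HasDiag (at (P ++ v ∷ v ∷ v ∷ Y)) ⟷ HasDiag (at (P ++ v ∷ v ∷ Y))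
triple-⟷ P v Y vle = ⟷-sym (⟷-cong (λ α → mk⇔ (λ z → z) (λ z → z))
    (λ α → mk⇔ (HasDiag-ext {duplicateAt (suc (length P)) F} {at (P ++ v ∷ v ∷ v ∷ Y)} (duplicateAt-list P v Y) α)
    (HasDiag-ext {at (P ++ v ∷ v ∷ v ∷ Y)} {duplicateAt (suc (length P)) F} (λ j → sym (duplicateAt-list P v Y j)) α))
                     (plateau-⟷ (suc (length P)) F (s≤s z≤n) (trans FK (sym FK1))
                         (subst (_< suc (length P)) (sym FK) (s≤s vle))))
  where
  F = at (P ++ v ∷ v ∷ Y)
  FK : F (suc (length P)) ≡ v
  FK = trans (cong (λ z → F (suc z)) (sym (+-identityʳ (length P)))) (at-++ʳ P (v ∷ v ∷ Y) 0)
  FK1 : F (suc (suc (length P))) ≡ v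
  FK1 = trans (cong (λ z → F (suc z)) (sym (+-comm (length P) 1))) (at-++ʳ P (v ∷ v ∷ Y) 1)

replicate-min2-⟷ : ∀ n P v X → v ≤ length P → HasDiag (at (P ++ replicate n v ++ X)) ⟷ HasDiag (at (P ++ replicate (min2 n) v ++ X))
replicate-min2-⟷ zero P v X _ = ⟷-refl
replicate-min2-⟷ (suc zero) P v X _ = ⟷-refl
replicate-min2-⟷ (suc (suc zero)) P v X _ = ⟷-refl
replicate-min2-⟷ (suc (suc (suc n))) P v X vle =
  ⟷-trans (triple-⟷ P v (replicate n v ++ X) vle)
    (subst (λ c → HasDiag (at (P ++ replicate (suc (suc n)) v ++ X)) ⟷ HasDiag (at (P ++ replicate c v ++ X)))
        (min2-≥2 n) (replicate-min2-⟷ (suc (suc n)) P v X vle))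

downBlocks-cap2-⟷ : ∀ i P s → i ≤ length P → HasDiag (at (P ++ downBlocks i s)) ⟷ HasDiag (at (P ++ downBlocks i (cap2 s)))
downBlocks-cap2-⟷ zero P s _ = ⟷-refl
downBlocks-cap2-⟷ (suc i) P s le =
  ⟷-trans (replicate-min2-⟷ (s (suc i)) P (suc i) (downBlocks i s) le)
   (subst₂ (λ d1 d2 → HasDiag (at d1) ⟷ HasDiag (at d2))
      (++-assoc P (replicate (min2 (s (suc i))) (suc i)) (downBlocks i s))
      (++-assoc P (replicate (min2 (s (suc i))) (suc i)) (downBlocks i (cap2 s)))
      (downBlocks-cap2-⟷ i (P ++ replicate (min2 (s (suc i))) (suc i)) s
          (≤-trans (n≤1+n i) (≤-trans le (≤-trans (m≤m+n (length P) _) (≤-reflexive (sym (length-++ P)))))))) 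

cap2-SameSize : ∀ q s → SameSize (InClass (dSeq q s)) (InClass (dSeq q (cap2 s)))
cap2-SameSize q s = HasDiag-⟷⇒SameSize (dSeq-positive q s) (dSeq-positive q (cap2 s))
  (downBlocks-cap2-⟷ q (stair q) s (≤-reflexive (sym (length-stair q))))

-- Shortening the staircase

-- lowerStair shortens the leading rows that stick out past the staircase and deletes the
-- first row that does not; raiseStair undoes this.
mutual
  lowerStair : ℕ → List ℕ → List ℕ
  lowerStair p [] = []
  lowerStair p (a ∷ β) = lowerStairCase p a β (suc (suc p) ≤? a)

  lowerStairCase : (p a : ℕ) (β : List ℕ) → Dec (suc (suc p) ≤ a) → List ℕ
  lowerStairCase p a β (yes _) = pred a ∷ lowerStair (pred p) β
  lowerStairCase p a β (no _) = β

mutual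
  raiseStair : ℕ → List ℕ → List ℕ
  raiseStair p [] = suc p ∷ []
  raiseStair p (b ∷ β) = raiseStairCase p b β (suc p ≤? b)

  raiseStairCase : (p b : ℕ) (β : List ℕ) → Dec (suc p ≤ b) → List ℕ
  raiseStairCase p b β (yes _) = suc b ∷ raiseStair (pred p) β
  raiseStairCase p b β (no _) = suc p ∷ b ∷ β

Lowerable : ℕ → List ℕ → Set
Lowerable p α = diag α (suc p) ≡ suc p × diag α (suc (suc p)) ≡ diag α (suc (suc (suc p))) × diag α (suc (suc p)) ≤ p

Raisable : ℕ → List ℕ → Set
Raisable p γ = diag γ p ≡ p × diag γ (suc p) ≡ diag γ (suc (suc p)) × diag γ (suc p) ≤ p

Lowerable-pred : ∀ p β → diag β p ≡ p → diag β (suc p) ≡ diag β (suc (suc p)) → suc (diag β (suc p)) ≤ p →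
  Σ ℕ (λ p' → p ≡ suc p' × Lowerable p' β)
Lowerable-pred zero β _ _ ()
Lowerable-pred (suc p') β lp e vβ = p' , refl , lp , e , ≤-pred vβ

Lowerable-top : ∀ p a β → IsPartition (a ∷ β) → suc (suc p) ≤ a → Lowerable p (a ∷ β) →
  suc (suc (suc p)) ≤ a × Σ ℕ (λ p' → p ≡ suc p' × Lowerable p' β)
Lowerable-top p a β ip le (f , e , v≤) with suc (suc (suc p)) ≤? a
... | no n = ⊥-elim (≤⇒≯ v≤ (subst (p <_) (sym vα) (n≤1+n (suc p))))
  where
  g1 = reaches-≤ a (suc (suc p)) le
  g2 = reaches-< a (suc (suc (suc p))) (≰⇒> n)
  inc : suc (diag β (suc p)) ≡ diag β (suc (suc p))
  inc = trans (cong (_+ diag β (suc p)) (sym g1)) (trans e (cong (_+ diag β (suc (suc p))) g2))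
  full : diag β (suc p) ≡ suc p
  full = diag-increase⇒full β (suc p) (IsPartition-tail a β ip) (subst (diag β (suc p) <_) inc ≤-refl)
  vα : diag (a ∷ β) (suc (suc p)) ≡ suc (suc p)
  vα = cong₂ _+_ g1 full
... | yes le3 = le3 , Lowerable-pred p β lp e' vβ
  where
  g0 = reaches-≤ a (suc p) (≤-trans (n≤1+n _) le)
  g1 = reaches-≤ a (suc (suc p)) le
  g2 = reaches-≤ a (suc (suc (suc p))) le3
  lp : diag β p ≡ p
  lp = suc-injective (trans (cong (_+ diag β p) (sym g0)) f)
  e' : diag β (suc p) ≡ diag β (suc (suc p))
  e' = suc-injective (trans (cong (_+ diag β (suc p)) (sym g1)) (trans e (cong (_+ diag β (suc (suc p))) g2)))
  vβ : suc (diag β (suc p)) ≤ p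
  vβ = subst (_≤ p) (cong (_+ diag β (suc p)) g1) v≤

Lowerable-nontop : ∀ p a β → IsPartition (a ∷ β) → ¬ (suc (suc p) ≤ a) → Lowerable p (a ∷ β) → a ≡ suc p × diag β p ≡ p
Lowerable-nontop p a β ip n (f , _ , _) = aeq , suc-injective
    (trans (cong (_+ diag β p) (sym (reaches-≤ a (suc p) (≤-reflexive (sym aeq))))) f)
  where
  aeq : a ≡ suc p
  aeq = ≤-antisym (≤-pred (≰⇒> n)) (diag-full⇒≤hd (a ∷ β) p f)

DiagLowered : ℕ → List ℕ → Set
DiagLowered p α = (∀ j → j ≤ p → diag (lowerStair p α) j ≡ diag α j) ×
    (∀ j → suc p ≤ j → diag (lowerStair p α) j ≡ diag α (suc j))

lowerStair-top : ∀ p' a' β → suc (suc (suc (suc p'))) ≤ suc a' → DiagLowered p' β →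
  (∀ j → j ≤ suc p' → diag (a' ∷ lowerStair p' β) j ≡ diag (suc a' ∷ β) j) ×
      (∀ j → suc (suc p') ≤ j → diag (a' ∷ lowerStair p' β) j ≡ diag (suc a' ∷ β) (suc j))
lowerStair-top p' a' β le ih = lo , hi
  where
  lo : ∀ j → j ≤ suc p' → diag (a' ∷ lowerStair p' β) j ≡ diag (suc a' ∷ β) j
  lo zero _ = refl
  lo (suc j) l = cong₂ _+_ (trans (reaches-≤ a' (suc j)
      (≤-trans l (≤-trans (n≤1+n _) (≤-trans (n≤1+n _) (≤-pred le)))))
      (sym (reaches-≤ a' j (≤-trans (n≤1+n j) (≤-trans l (≤-trans (n≤1+n _) (≤-trans (n≤1+n _) (≤-pred le))))))))
      (proj₁ ih j (≤-pred l))
  hi : ∀ j → suc (suc p') ≤ j → diag (a' ∷ lowerStair p' β) j ≡ diag (suc a' ∷ β) (suc j)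
  hi (suc j) l = cong (reaches a' (suc j) +_) (proj₂ ih j (≤-pred l))

lowerStair-diag : ∀ p α → IsPartition α → Lowerable p α → DiagLowered p α
lowerStair-diag p [] _ (() , _)
lowerStair-diag p (a ∷ β) ip hyp with suc (suc p) ≤? a
... | yes le with Lowerable-top p a β ip le hyp
...   | le3 , p' , refl , hypβ with a | le3
...     | suc a' | le3' = lowerStair-top p' a' β le3' (lowerStair-diag p' β (IsPartition-tail _ β ip) hypβ)
lowerStair-diag p (a ∷ β) ip hyp | no n with Lowerable-nontop p a β ip n hyp
... | refl , lp = lo , hi
  where
  ipβ = IsPartition-tail _ β ip
  lo : ∀ j → j ≤ p → diag β j ≡ diag (suc p ∷ β) j
  lo j l = trans (diag-full-below β p ipβ lp j l)
      (sym (diag-full-below (suc p ∷ β) (suc p) ip (proj₁ hyp) j (≤-trans l (n≤1+n p))))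
  hi : ∀ j → suc p ≤ j → diag β j ≡ diag (suc p ∷ β) (suc j)
  hi j l = sym (cong (_+ diag β j) (reaches-< (suc p) (suc j) (s≤s l)))

DiagRaised : ℕ → List ℕ → Set
DiagRaised p γ = (∀ j → j ≤ p → diag (raiseStair p γ) j ≡ diag γ j) × diag (raiseStair p γ) (suc p) ≡ suc p ×
    (∀ j → suc p ≤ j → diag (raiseStair p γ) (suc j) ≡ diag γ j)

Raisable-pred : ∀ p b β → suc (suc p) ≤ b → diag (b ∷ β) p ≡ p → diag β p ≡ diag β (suc p) →
  suc (diag β p) ≤ p → Σ ℕ (λ p' → p ≡ suc p' × Raisable p' β)
Raisable-pred zero b β _ _ _ ()
Raisable-pred (suc p') b β le lp e vβ = p' , refl , suc-injective
    (trans (cong (_+ diag β p') (sym (reaches-≤ b (suc p') (≤-trans (n≤1+n _) (≤-trans (n≤1+n _) le))))) lp) , e , ≤-pred vβ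

Raisable-top : ∀ p b β → IsPartition (b ∷ β) → suc p ≤ b → Raisable p (b ∷ β) →
  suc (suc p) ≤ b × Σ ℕ (λ p' → p ≡ suc p' × Raisable p' β)
Raisable-top p b β ip le (lp , e , v≤) with suc (suc p) ≤? b
... | no n = ⊥-elim (≤⇒≯ v≤ (subst (p <_) (sym vγ) ≤-refl))
  where
  g1 = reaches-≤ b (suc p) le
  g2 = reaches-< b (suc (suc p)) (≰⇒> n)
  inc : suc (diag β p) ≡ diag β (suc p)
  inc = trans (cong (_+ diag β p) (sym g1)) (trans e (cong (_+ diag β (suc p)) g2))
  full : diag β p ≡ p
  full = diag-increase⇒full β p (IsPartition-tail b β ip) (subst (diag β p <_) inc ≤-refl)
  vγ : diag (b ∷ β) (suc p) ≡ suc p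
  vγ = cong₂ _+_ g1 full
... | yes le2 = le2 , Raisable-pred p b β le2 lp e' vβ
  where
  g1 = reaches-≤ b (suc p) le
  g2 = reaches-≤ b (suc (suc p)) le2
  e' : diag β p ≡ diag β (suc p)
  e' = suc-injective (trans (cong (_+ diag β p) (sym g1)) (trans e (cong (_+ diag β (suc p)) g2)))
  vβ : suc (diag β p) ≤ p
  vβ = subst (_≤ p) (cong (_+ diag β p) g1) v≤

DiagRaisedBy : ℕ → List ℕ → Set
DiagRaisedBy p γ = (∀ j → j ≤ p → diag (suc p ∷ γ) j ≡ diag γ j) × diag (suc p ∷ γ) (suc p) ≡ suc p ×
    (∀ j → suc p ≤ j → diag (suc p ∷ γ) (suc j) ≡ diag γ j)

raiseStair-nontop : ∀ p γ → IsPartition γ → diag γ p ≡ p → DiagRaisedBy p γ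
raiseStair-nontop p γ ip lp = lo , cong₂ _+_ (reaches-≤ (suc p) (suc p) ≤-refl) lp , hi
  where
  lo : ∀ j → j ≤ p → diag (suc p ∷ γ) j ≡ diag γ j
  lo zero _ = sym (diag-0 γ)
  lo (suc j) l = trans (cong₂ _+_ (reaches-≤ (suc p) (suc j) (≤-trans l (n≤1+n p)))
      (diag-full-below γ p ip lp j (≤-trans (n≤1+n j) l))) (sym (diag-full-below γ p ip lp (suc j) l))
  hi : ∀ j → suc p ≤ j → diag (suc p ∷ γ) (suc j) ≡ diag γ j
  hi j l = cong (_+ diag γ j) (reaches-< (suc p) (suc j) (s≤s l))

raiseStair-top : ∀ p' b β → suc (suc (suc p')) ≤ b → DiagRaised p' β →
  (∀ j → j ≤ suc p' → diag (suc b ∷ raiseStair p' β) j ≡ diag (b ∷ β) j) × diag (suc b ∷ raiseStair p' β)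
      (suc (suc p')) ≡ suc (suc p') × (∀ j → suc (suc p') ≤ j → diag (suc b ∷ raiseStair p' β) (suc j) ≡ diag (b ∷ β) j)
raiseStair-top p' b β le (ilo , imid , ihi) = lo , trans
    (cong₂ _+_ (reaches-≤ b (suc p') (≤-trans (n≤1+n _) (≤-trans (n≤1+n _) le))) imid) refl , hi
  where
  lo : ∀ j → j ≤ suc p' → diag (suc b ∷ raiseStair p' β) j ≡ diag (b ∷ β) j
  lo zero _ = refl
  lo (suc j) l = cong₂ _+_ (trans (reaches-≤ b j
      (≤-trans (n≤1+n j) (≤-trans l (≤-trans (n≤1+n _) (≤-trans (n≤1+n _) le)))))
      (sym (reaches-≤ b (suc j) (≤-trans l (≤-trans (n≤1+n _) (≤-trans (n≤1+n _) le)))))) (ilo j (≤-pred l))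
  hi : ∀ j → suc (suc p') ≤ j → diag (suc b ∷ raiseStair p' β) (suc j) ≡ diag (b ∷ β) j
  hi (suc j) l = cong (reaches b (suc j) +_) (ihi j (≤-pred l))

raiseStair-diag : ∀ p γ → IsPartition γ → Raisable p γ → DiagRaised p γ
raiseStair-diag p [] ip hyp = raiseStair-nontop p [] ip (proj₁ hyp)
raiseStair-diag p (b ∷ β) ip hyp with suc p ≤? b
... | no _ = raiseStair-nontop p (b ∷ β) ip (proj₁ hyp)
... | yes le with Raisable-top p b β ip le hyp
...   | le2 , p' , refl , hypβ = raiseStair-top p' b β le2 (raiseStair-diag p' β (IsPartition-tail b β ip) hypβ)

lowerStair-head-≤ : ∀ p δ → IsPartition δ → hd (lowerStair p δ) ≤ hd δ
lowerStair-head-≤ p [] _ = z≤n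
lowerStair-head-≤ p (d ∷ δ) ip with suc (suc p) ≤? d
... | yes _ = pred[n]≤n
... | no _ = IsPartition-head d δ ip

lowerStair-head-top : ∀ p δ → suc (suc p) ≤ hd δ → hd (lowerStair p δ) ≡ pred (hd δ)
lowerStair-head-top p (d ∷ δ) le with suc (suc p) ≤? d
... | yes _ = refl
... | no n = ⊥-elim (n le)

lowerStair-IsPartition : ∀ p α → IsPartition α → Lowerable p α → IsPartition (lowerStair p α)
lowerStair-IsPartition p [] ip _ = ip
lowerStair-IsPartition p (a ∷ β) ip hyp with suc (suc p) ≤? a
... | no _ = IsPartition-tail a β ip
... | yes le with Lowerable-top p a β ip le hyp
...   | le3 , p' , refl , hypβ = IsPartition-∷ (pred a) (lowerStair p' β) (≤-trans (s≤s z≤n) (pred-mono-≤ le3)) hdle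
    (lowerStair-IsPartition p' β (IsPartition-tail a β ip) hypβ)
  where
  hdle : hd (lowerStair p' β) ≤ pred a
  hdle with hd β <? a
  ... | yes lt = ≤-trans (lowerStair-head-≤ p' β (IsPartition-tail a β ip)) (pred-mono-≤ lt)
  ... | no nlt = ≤-reflexive (trans (lowerStair-head-top p' β
      (subst (suc (suc p') ≤_) (sym hβ) (≤-trans (≤-trans (n≤1+n (suc (suc p'))) (n≤1+n (suc (suc (suc p'))))) le3)))
      (cong pred hβ))
    where
    hβ : hd β ≡ a
    hβ = ≤-antisym (IsPartition-head a β ip) (≮⇒≥ nlt)

raiseStair-head : ∀ p δ → hd (raiseStair p δ) ≡ suc (hd δ) ⊎ hd (raiseStair p δ) ≡ suc p
raiseStair-head p [] = inj₂ refl
raiseStair-head p (b ∷ β) with suc p ≤? b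
... | yes _ = inj₁ refl
... | no _ = inj₂ refl

raiseStair-IsPartition : ∀ p γ → IsPartition γ → Raisable p γ → IsPartition (raiseStair p γ)
raiseStair-IsPartition p [] _ _ = (s≤s z≤n ∷ []) , [-]
raiseStair-IsPartition p (b ∷ β) ip hyp with suc p ≤? b
... | no n = IsPartition-∷ (suc p) (b ∷ β) (s≤s z≤n) (≤-trans (≤-pred (≰⇒> n)) (n≤1+n p)) ip
... | yes le with Raisable-top p b β ip le hyp
...   | le2 , p' , refl , hypβ = IsPartition-∷ (suc b) (raiseStair p' β) (s≤s z≤n) hdle
    (raiseStair-IsPartition p' β (IsPartition-tail b β ip) hypβ)
  where
  hdle : hd (raiseStair p' β) ≤ suc b
  hdle with raiseStair-head p' β
  ... | inj₁ e = ≤-trans (≤-reflexive e) (s≤s (IsPartition-head b β ip))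
  ... | inj₂ e = ≤-trans (≤-reflexive e) (≤-trans (≤-trans (n≤1+n _) le) (n≤1+n b))

lowerStair-raiseStair : ∀ p γ → IsPartition γ → Raisable p γ → lowerStair p (raiseStair p γ) ≡ γ
lowerStair-raiseStair p [] _ _ with suc (suc p) ≤? suc p
... | yes le = ⊥-elim (<-irrefl refl le)
... | no _ = refl
lowerStair-raiseStair p (b ∷ β) ip hyp with suc p ≤? b
... | no _ = go
  where
  go : lowerStair p (suc p ∷ b ∷ β) ≡ b ∷ β
  go with suc (suc p) ≤? suc p
  ... | yes le = ⊥-elim (<-irrefl refl le)
  ... | no _ = refl
... | yes le with Raisable-top p b β ip le hyp
...   | le2 , p' , refl , hypβ = go
  where
  go : lowerStair (suc p') (suc b ∷ raiseStair p' β) ≡ b ∷ β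
  go with suc (suc (suc p')) ≤? suc b
  ... | yes _ = cong (b ∷_) (lowerStair-raiseStair p' β (IsPartition-tail b β ip) hypβ)
  ... | no n = ⊥-elim (n (≤-trans le2 (n≤1+n b)))

no-equal-rows-after-top : ∀ p β' → IsPartition (suc p ∷ suc p ∷ β') →
  diag (suc p ∷ suc p ∷ β') (suc (suc p)) ≡ diag (suc p ∷ suc p ∷ β') (suc (suc (suc p))) →
  diag (suc p ∷ suc p ∷ β') (suc (suc p)) ≤ p → ⊥
no-equal-rows-after-top p β' ip e v≤ = ≤⇒≯ v≤ (subst (p <_) (sym vα) ≤-refl)
  where
  g0 = reaches-< (suc p) (suc (suc p)) ≤-refl
  g1 = reaches-< (suc p) (suc (suc (suc p))) (≤-trans (n≤1+n _) (s≤s ≤-refl))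
  g2 = reaches-≤ (suc p) (suc p) ≤-refl
  l1 : diag (suc p ∷ suc p ∷ β') (suc (suc p)) ≡ suc (diag β' p)
  l1 = trans (cong (_+ (reaches (suc p) (suc p) + diag β' p)) g0) (cong (_+ diag β' p) g2)
  l2 : diag (suc p ∷ suc p ∷ β') (suc (suc (suc p))) ≡ diag β' (suc p)
  l2 = trans (cong (_+ (reaches (suc p) (suc (suc p)) + diag β' (suc p))) g1) (cong (_+ diag β' (suc p)) g0)
  full : diag β' p ≡ p
  full = diag-increase⇒full β' p (IsPartition-tail _ β' (IsPartition-tail _ _ ip))
      (subst (diag β' p <_) (trans (sym l1) (trans e l2)) ≤-refl)
  vα : diag (suc p ∷ suc p ∷ β') (suc (suc p)) ≡ suc p
  vα = trans l1 (cong suc full)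

raiseStair-lowerStair : ∀ p α → IsPartition α → Lowerable p α → raiseStair p (lowerStair p α) ≡ α
raiseStair-lowerStair p [] _ (() , _)
raiseStair-lowerStair p (a ∷ β) ip hyp with suc (suc p) ≤? a
... | yes le with Lowerable-top p a β ip le hyp
...   | le3 , p' , refl , hypβ with a | le3
...     | suc a' | s≤s le3' = go
  where
  go : raiseStair (suc p') (a' ∷ lowerStair p' β) ≡ suc a' ∷ β
  go with suc (suc p') ≤? a'
  ... | yes _ = cong (suc a' ∷_) (raiseStair-lowerStair p' β (IsPartition-tail _ β ip) hypβ)
  ... | no n = ⊥-elim (n (≤-trans (n≤1+n _) le3'))
raiseStair-lowerStair p (a ∷ β) ip hyp | no n with Lowerable-nontop p a β ip n hyp
... | refl , lp = go β ip hyp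
  where
  go : ∀ β → IsPartition (suc p ∷ β) → Lowerable p (suc p ∷ β) → raiseStair p β ≡ suc p ∷ β
  go [] _ _ = refl
  go (b ∷ β') ipb (_ , e , v≤) with suc p ≤? b
  ... | no _ = refl
  ... | yes le with ≤-antisym (IsPartition-head (suc p) (b ∷ β') ipb) le
  ...   | refl = ⊥-elim (no-equal-rows-after-top p β' ipb e v≤)

at-stair-++ : ∀ m Z j → j < m → at (stair m ++ Z) (suc j) ≡ suc j
at-stair-++ m Z j lt = trans (at-++ˡ (stair m) Z j (subst (j <_) (sym (length-stair m)) lt)) (at-stair m j lt)

at-stair-suc-++-offset : ∀ p Z t → at (stair (suc p) ++ Z) (suc (suc (p + t))) ≡ at (stair p ++ Z) (suc (p + t))
at-stair-suc-++-offset p Z t = trans (cong (λ z → at (stair (suc p) ++ Z) (suc z))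
    (cong (_+ t) (sym (length-stair (suc p)))))
              (trans (at-++ʳ (stair (suc p)) Z t)
                  (sym (trans (cong (λ z → at (stair p ++ Z) (suc (z + t))) (sym (length-stair p))) (at-++ʳ (stair p) Z t))))

at-stair-suc-++ : ∀ p Z j → p ≤ j → at (stair (suc p) ++ Z) (suc (suc j)) ≡ at (stair p ++ Z) (suc j)
at-stair-suc-++ p Z j le = subst (λ z → at (stair (suc p) ++ Z) (suc (suc z)) ≡ at (stair p ++ Z) (suc z))
    (m+[n∸m]≡n le) (at-stair-suc-++-offset p Z (j ∸ p))

at-stair-++-plateau : ∀ p v Y t → t ≤ 1 → at (stair p ++ v ∷ v ∷ Y) (suc (p + t)) ≡ v
at-stair-++-plateau p v Y zero _ = trans (cong (λ z → at (stair p ++ v ∷ v ∷ Y) (suc (z + 0))) (sym (length-stair p)))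
    (at-++ʳ (stair p) (v ∷ v ∷ Y) 0)
at-stair-++-plateau p v Y (suc (suc t)) (s≤s ())
at-stair-++-plateau p v Y (suc zero) _ = trans (cong (λ z → at (stair p ++ v ∷ v ∷ Y) (suc (z + 1)))
    (sym (length-stair p))) (at-++ʳ (stair p) (v ∷ v ∷ Y) 1)

HasDiag-stair⇒full : ∀ p Z γ → (∀ j → diag γ (suc j) ≡ at (stair p ++ Z) (suc j)) → diag γ p ≡ p
HasDiag-stair⇒full zero Z γ h = diag-0 γ
HasDiag-stair⇒full (suc p') Z γ h = trans (h p') (at-stair-++ (suc p') Z p' ≤-refl)

lowerStair-⟷ : ∀ p v Y → v ≤ p → HasDiag (at (stair (suc p) ++ v ∷ v ∷ Y)) ⟷ HasDiag (at (stair p ++ v ∷ v ∷ Y))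
lowerStair-⟷ p v Y v≤ = record
  { to = lowerStair p ; from = raiseStair p
  ; to-resp = to-resp ; from-resp = from-resp
  ; from∘to = λ α (ip , h) → raiseStair-lowerStair p α ip (hyp {α} h)
  ; to∘from = λ γ (ip , h) → lowerStair-raiseStair p γ ip (hyp' {γ} h) }
  where
  Z = v ∷ v ∷ Y
  F = at (stair (suc p) ++ Z)
  F' = at (stair p ++ Z)
  F'p1 : F' (suc p) ≡ v
  F'p1 = trans (cong (λ z → F' (suc z)) (sym (+-identityʳ p))) (at-stair-++-plateau p v Y 0 z≤n)
  F'p2 : F' (suc (suc p)) ≡ v
  F'p2 = trans (cong (λ z → F' (suc z)) (+-comm 1 p)) (at-stair-++-plateau p v Y 1 ≤-refl)
  hyp : ∀ {α} → (∀ j → diag α (suc j) ≡ F (suc j)) → Lowerable p α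
  hyp {α} h = trans (h p) (at-stair-++ (suc p) Z p ≤-refl) , trans (h (suc p))
      (trans (at-stair-suc-++ p Z p ≤-refl)
      (trans F'p1 (sym (trans (h (suc (suc p))) (trans (at-stair-suc-++ p Z (suc p) (n≤1+n p)) F'p2))))) ,
              subst (_≤ p) (sym (trans (h (suc p)) (trans (at-stair-suc-++ p Z p ≤-refl) F'p1))) v≤
  hyp' : ∀ {γ} → (∀ j → diag γ (suc j) ≡ F' (suc j)) → Raisable p γ
  hyp' {γ} h = lp , trans (h p) (trans F'p1 (sym (trans (h (suc p)) F'p2))) , subst (_≤ p) (sym (trans (h p) F'p1)) v≤
    where
    lp : diag γ p ≡ p
    lp = HasDiag-stair⇒full p Z γ h
  to-resp : ∀ α → HasDiag F α → HasDiag F' (lowerStair p α)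
  to-resp α (ip , h) = lowerStair-IsPartition p α ip (hyp {α} h) , lv
    where
    hl = lowerStair-diag p α ip (hyp {α} h)
    lv : ∀ j → diag (lowerStair p α) (suc j) ≡ F' (suc j)
    lv j with suc j ≤? p
    ... | yes le = trans (proj₁ hl (suc j) le)
        (trans (h j) (trans (at-stair-++ (suc p) Z j (≤-trans le (n≤1+n p))) (sym (at-stair-++ p Z j le))))
    ... | no nle = trans (proj₂ hl (suc j) (≰⇒> nle)) (trans (h (suc j)) (at-stair-suc-++ p Z j (≤-pred (≰⇒> nle))))
  from-resp : ∀ γ → HasDiag F' γ → HasDiag F (raiseStair p γ)
  from-resp γ (ip , h) = raiseStair-IsPartition p γ ip (hyp' {γ} h) , lv
    where
    hl = raiseStair-diag p γ ip (hyp' {γ} h)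
    lv : ∀ j → diag (raiseStair p γ) (suc j) ≡ F (suc j)
    lv j with suc j ≤? p
    ... | yes le = trans (proj₁ hl (suc j) le)
        (trans (h j) (trans (at-stair-++ p Z j le) (sym (at-stair-++ (suc p) Z j (≤-trans le (n≤1+n p))))))
    ... | no nle with j ≟ p
    ...   | yes refl = trans (proj₁ (proj₂ hl)) (sym (at-stair-++ (suc p) Z j ≤-refl))
    ...   | no nj with j
    ...     | zero = ⊥-elim (nj (sym (n≤0⇒n≡0 (≤-pred (≰⇒> nle)))))
    ...     | suc j' = trans (proj₂ (proj₂ hl) (suc j') (≤∧≢⇒< (≤-pred (≰⇒> nle)) (λ e → nj (sym e))))
        (trans (h j') (sym (at-stair-suc-++ p Z j' (≤-pred (≤∧≢⇒< (≤-pred (≰⇒> nle)) (λ e → nj (sym e)))))))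

lowerStairs-⟷ : ∀ d k Y → HasDiag (at (stair (k + d) ++ k ∷ k ∷ Y)) ⟷ HasDiag (at (stair k ++ k ∷ k ∷ Y))
lowerStairs-⟷ zero k Y = subst (λ z → HasDiag (at (stair z ++ k ∷ k ∷ Y)) ⟷ HasDiag (at (stair k ++ k ∷ k ∷ Y)))
    (sym (+-identityʳ k)) ⟷-refl
lowerStairs-⟷ (suc d) k Y = subst (λ z → HasDiag (at (stair z ++ k ∷ k ∷ Y)) ⟷ HasDiag (at (stair k ++ k ∷ k ∷ Y)))
    (sym (+-suc k d))
  (⟷-trans (lowerStair-⟷ (k + d) k Y (m≤m+n k d)) (lowerStairs-⟷ d k Y))

stair-shorten-SameSize : ∀ q k s → 0 < k → k ≤ q → 2 ≤ s k →
  SameSize (InClass (stair q ++ downBlocks k s)) (InClass (stair k ++ downBlocks k s))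
stair-shorten-SameSize q (suc k) s _ k≤q sk with ≥2⇒suc-suc (s (suc k)) sk
... | t , e = HasDiag-⟷⇒SameSize (stair++downBlocks-positive q (suc k) s) (stair++downBlocks-positive (suc k) (suc k) s)
               (subst₂ (λ d d' → HasDiag (at d) ⟷ HasDiag (at d'))
                  (trans (cong (λ z → stair z ++ suc k ∷ suc k ∷ Y) (m+[n∸m]≡n k≤q))
                      (cong (stair q ++_) (sym (downBlocks-two k s t e))))
                  (cong (stair (suc k) ++_) (sym (downBlocks-two k s t e)))
                  (lowerStairs-⟷ (q ∸ suc k) (suc k) Y))
  where
  Y = replicate t (suc k) ++ downBlocks k s

corollary4p7 : ((n q : ℕ) (s : ℕ → ℕ) → 0 < n → 0 < q → InΔ n (dSeq q s) →
    ((∀ i → 1 ≤ i → i < q → 2 ≤ s i) → HasSize (InClassParts (dSeq q s) q) 1)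
    × ((∀ i → 1 ≤ i → i < q → 2 ≤ s i) → 1 ≤ s q →
         HasSize (InClass (dSeq q s)) (bProduct q (dSeq q s)))
    × SameSize (InClass (dSeq q s)) (InClass (dSeq q (cap2 s))))
  × ((m : ℕ) → 0 < m →
       Σ ℕ λ n' → Σ (List ℕ) λ α → 0 < n' × IsPartitionOf n' α × HasSize (InClass (δ α)) m)
  × ((n q k : ℕ) (s : ℕ → ℕ) → 0 < n → 0 < k → k < q → 2 ≤ s k →
       InΔ n (stair q ++ downBlocks k s) →
       SameSize (InClass (stair q ++ downBlocks k s))
                (InClass (stair k ++ downBlocks k s)))
corollary4p7 =
    (λ _ q s _ q>0 _ → dSeq-parts-unique q s , count-dSeq-bProduct q s q>0 , cap2-SameSize q s)
  , every-size-occurs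
  , λ _ q k s _ k>0 k<q sk≥2 _ → stair-shorten-SameSize q k s k>0 (<⇒≤ k<q) sk≥2
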